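{- Let $n\ge0$ be an integer, $\beta$ a complex number, and $G_n^\beta=U_nE^{n\beta}U_n^{ -1}$ acting on the space $\mathcal P_n$ of complex polynomials of degree at most $n$. Then $$G_n^{ -\beta}=J_n\,G_n^\beta\,J_n ,$$ where $J_n$ is the operator $x^p\mapsto x^{n-p}$ on $\mathcal P_n$.
   Context: The Euler polynomials $A_k(x)$ are defined by $\frac{A_k(x)}{(1-x)^{k+1}}=\sum_{m\ge0}m^kx^m$, with $A_0=1$. $U_n$ is the linear operator on $\mathcal P_n$ with $U_n x^p=\frac1{n!}(1-x)^{n-p}A_p(x)$, $p=0,\dots,n$; it is invertible with $U_n^{ -1}x^p=(x)_p[x+1]_{n-p}$ (falling and rising factorials). $E^{c}$ is the shift operator $f(x)\mapsto f(x+c)$. -}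

module Defs where

open import Level using (_⊔_)
open import Data.Nat as ℕ using (ℕ; zero; suc; _∸_; _≤ᵇ_)
open import Data.Nat.Combinatorics using (_C_)
open import Data.Integer as ℤ using (ℤ; +_; -[1+_])
open import Data.Fin using (Fin; toℕ; opposite)
open import Data.Fin.Properties using (_≟_)
open import Data.Bool using (if_then_else_)
open import Relation.Nullary.Decidable using (⌊_⌋)
open import Algebra.Bundles using (CommutativeRing)

-- Polynomials with integer coefficients, represented as coefficient
-- functions ℕ → ℤ (coefficient of x^k at k); all polynomials built
-- below have finite support.

IPoly : Set
IPoly = ℕ → ℤ

sumUpTo : ℕ → (ℕ → ℤ) → ℤ
sumUpTo zero    f = f 0
sumUpTo (suc k) f = sumUpTo k f ℤ.+ f (suc k)

_·P_ : IPoly → IPoly → IPoly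
(f ·P g) k = sumUpTo k (λ i → f i ℤ.* g (k ∸ i))

oneP : IPoly
oneP zero    = + 1
oneP (suc _) = + 0

mulLin : ℤ → IPoly → IPoly
mulLin a f zero    = a ℤ.* f 0
mulLin a f (suc k) = f k ℤ.+ a ℤ.* f (suc k)

falling : ℕ → IPoly
falling zero    = oneP
falling (suc p) = mulLin (ℤ.- (+ p)) (falling p)

rising1 : ℕ → IPoly
rising1 zero    = oneP
rising1 (suc m) = mulLin (+ suc m) (rising1 m)

sgn : ℕ → ℤ
sgn zero          = + 1
sgn (suc zero)    = ℤ.- (+ 1)
sgn (suc (suc i)) = sgn i

oneMinusPow : ℕ → IPoly
oneMinusPow m i = sgn i ℤ.* (+ (m C i))

-- Euler polynomial A_k, defined by A_k(x) = (1-x)^{k+1} Σ_{m≥0} m^k x^m,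
-- i.e. coefficient of x^j is Σ_{i=0}^{j} (-1)^i C(k+1,i) (j-i)^k
-- (with 0^0 = 1, so A_0 = 1).
euler : ℕ → IPoly
euler k j = sumUpTo j (λ i → oneMinusPow (suc k) i ℤ.* (+ ((j ∸ i) ℕ.^ k)))

-- n! ⋅ U_n x^p = (1-x)^{n-p} A_p(x)
nfactU : ℕ → ℕ → IPoly
nfactU n p = oneMinusPow (n ∸ p) ·P euler p

Uinv : ℕ → ℕ → IPoly
Uinv n p = falling p ·P rising1 (n ∸ p)

-- Linear operators on P_n over a commutative ring R, as (n+1)×(n+1)
-- matrices: M i j = coefficient of x^i in M(x^j).

module Ops {c ℓ} (R : CommutativeRing c ℓ) where
  open CommutativeRing R

  Mat : ℕ → Set c
  Mat n = Fin (suc n) → Fin (suc n) → Carrier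

  _≋_ : ∀ {n} → Mat n → Mat n → Set ℓ
  M ≋ N = ∀ i j → M i j ≈ N i j

  _×ℕ_ : ℕ → Carrier → Carrier
  zero  ×ℕ x = 0#
  suc m ×ℕ x = x + m ×ℕ x

  _^ℕ_ : Carrier → ℕ → Carrier
  x ^ℕ zero  = 1#
  x ^ℕ suc m = x * x ^ℕ m

  fromℤ : ℤ → Carrier
  fromℤ (+ m)      = m ×ℕ 1#
  fromℤ -[1+ m ]   = - (suc m ×ℕ 1#)

  sumFin : ∀ m → (Fin m → Carrier) → Carrier
  sumFin zero    f = 0#
  sumFin (suc m) f = f Fin.zero + sumFin m (λ i → f (Fin.suc i))

  _⊙_ : ∀ {n} → Mat n → Mat n → Mat n
  _⊙_ {n} M N i j = sumFin (suc n) (λ k → M i k * N k j)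

  -- given inv m = 1/(m+1), the element 1/n! = Π_{m<n} inv m
  invFact : (ℕ → Carrier) → ℕ → Carrier
  invFact inv zero    = 1#
  invFact inv (suc n) = inv n * invFact inv n

  Uop : (ℕ → Carrier) → (n : ℕ) → Mat n
  Uop inv n i p = invFact inv n * fromℤ (nfactU n (toℕ p) (toℕ i))

  Uinvop : (n : ℕ) → Mat n
  Uinvop n i p = fromℤ (Uinv n (toℕ p) (toℕ i))

  -- shift E^c : x^j ↦ (x+c)^j = Σ_i C(j,i) c^{j-i} x^i
  shift : (n : ℕ) → Carrier → Mat n
  shift n c i j = (toℕ j C toℕ i) ×ℕ (c ^ℕ (toℕ j ∸ toℕ i))

  G : (ℕ → Carrier) → (n : ℕ) → Carrier → Mat n
  G inv n β = (Uop inv n ⊙ shift n (n ×ℕ β)) ⊙ Uinvop n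

  J : (n : ℕ) → Mat n
  J n i p = if ⌊ i ≟ opposite p ⌋ then 1# else 0#

  IsNatInverses : (ℕ → Carrier) → Set ℓ
  IsNatInverses inv = ∀ m → (suc m ×ℕ 1#) * inv m ≈ 1#

module Submission where

-- Write Z = n!·U_n and W = U_n^{-1}, both integer matrices, so that
-- G_n^β = (1/n!) Z E^{nβ} W, and let P be the matrix of the substitution
-- h(x) ↦ (-1)^n h(-1-x), with entries P(j,p) = (-1)^{n+p} C(p,j).  Then
--  (a) J Z = Z P: Z(i,p) = Σ_{t≤i} (-1)^t C(n+1,t) (i-t)^p, and the (n+1)-st
--      finite difference of (a-t)^p vanishes for p ≤ n;
--  (b) W J = P W: x ↦ -1-x exchanges the factors of (x)_p and [x+1]_{n-p};
--  (c) P E^c P = E^{-c}: P = (-1)^n E^1 D with D = diag((-1)^j), D E^c D = E^{-c}.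
-- Hence J G^β J = (1/n!) Z (P E^{nβ} P) W = G^{-β}; the factor 1/n! is an
-- arbitrary scalar here.

open import Defs
open import Data.Nat as ℕ using (ℕ; zero; suc; _∸_; _≤_; _<_; z≤n; s≤s; _!; NonZero)
import Data.Nat.Properties as ℕP
open import Data.Nat.Combinatorics
  using (_C_; nCk+nC[k+1]≡[n+1]C[k+1]; k>n⇒nCk≡0; nCn≡1; nCk≡nC[n∸k]; nCk≡n!/k![n-k]!; k![n∸k]!∣n!)
open import Data.Nat.DivMod using (_/_; m/n*n≡m)
open import Data.Integer as Int using (ℤ; +_; -[1+_]; _⊖_)
import Data.Integer.Properties as ℤP
open import Data.Fin as Fin using (Fin; toℕ; opposite)
import Data.Fin.Properties as FinP
open import Data.Bool using (if_then_else_)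
open import Data.Empty using (⊥-elim)
open import Relation.Nullary using (Dec; yes; no)
open import Relation.Nullary.Decidable using (⌊_⌋)
open import Relation.Binary.PropositionalEquality as ≡ using (_≡_; _≢_; _≗_)
open import Relation.Binary.Bundles using (Setoid)
open import Function using (_∘_)
open import Algebra.Bundles using (CommutativeRing; Semiring)
import Algebra.Definitions.RawMonoid as RawMonoid
import Algebra.Definitions.RawSemiring as RawSemiring
import Algebra.Properties.Semiring.Binomial as Binomial
import Algebra.Properties.Semiring.Sum as SemiringSum
import Algebra.Properties.Semiring.Mult as SemiringMult
import Algebra.Properties.Ring as RingProperties
import Algebra.Properties.CommutativeSemigroup as CommutativeSemigroupProperties

module RingFacts {c ℓ} (R : CommutativeRing c ℓ) where
  open CommutativeRing R
  open Ops R using (_×ℕ_; _^ℕ_; sumFin)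
  open RingProperties ring using (-‿+-comm; -‿distribˡ-*; -‿distribʳ-*; -‿involutive; -0#≈0#)
  open RawMonoid +-rawMonoid using (_×_)
  open RawSemiring (Semiring.rawSemiring semiring) using (_^_)
  open SemiringMult semiring using (×-homo-+; ×1-homo-*; ×-assoc-*; ×-congʳ)
  open SemiringSum semiring using (sum; sum-cong-≋; sum-replicate-zero)
  open CommutativeSemigroupProperties *-commutativeSemigroup using (x∙yz≈y∙xz)
  open CommutativeSemigroupProperties +-commutativeSemigroup using () renaming (interchange to +-interchange)
  open import Relation.Binary.Reasoning.Setoid setoid

  x-[y+x]≈-y : ∀ x y → x + - (y + x) ≈ - y
  x-[y+x]≈-y x y = begin
    x + - (y + x)       ≈⟨ +-congˡ (-‿+-comm y x) ⟨
    x + (- y + - x)     ≈⟨ +-congˡ (+-comm _ _) ⟩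
    x + (- x + - y)     ≈⟨ +-assoc _ _ _ ⟨
    (x + - x) + - y     ≈⟨ +-congʳ (-‿inverseʳ x) ⟩
    0# + - y            ≈⟨ +-identityˡ _ ⟩
    - y                 ∎

  ×ℕ≡× : ∀ m x → m ×ℕ x ≡ m × x
  ×ℕ≡× zero    x = ≡.refl
  ×ℕ≡× (suc m) x = ≡.cong (_+_ x) (×ℕ≡× m x)

  ^ℕ≡^ : ∀ x m → x ^ℕ m ≡ x ^ m
  ^ℕ≡^ x zero    = ≡.refl
  ^ℕ≡^ x (suc m) = ≡.cong (x *_) (^ℕ≡^ x m)

  ν : ℕ → Carrier
  ν m = m ×ℕ 1#

  ν-+ : ∀ m n → ν (m ℕ.+ n) ≈ ν m + ν n
  ν-+ m n = begin
    (m ℕ.+ n) ×ℕ 1#       ≡⟨ ×ℕ≡× (m ℕ.+ n) 1# ⟩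
    (m ℕ.+ n) × 1#        ≈⟨ ×-homo-+ 1# m n ⟩
    m × 1# + n × 1#       ≡⟨ ≡.cong₂ _+_ (≡.sym (×ℕ≡× m 1#)) (≡.sym (×ℕ≡× n 1#)) ⟩
    ν m + ν n             ∎

  ν-* : ∀ m n → ν (m ℕ.* n) ≈ ν m * ν n
  ν-* m n = begin
    (m ℕ.* n) ×ℕ 1#       ≡⟨ ×ℕ≡× (m ℕ.* n) 1# ⟩
    (m ℕ.* n) × 1#        ≈⟨ ×1-homo-* m n ⟩
    m × 1# * n × 1#       ≡⟨ ≡.cong₂ _*_ (≡.sym (×ℕ≡× m 1#)) (≡.sym (×ℕ≡× n 1#)) ⟩
    ν m * ν n             ∎

  ×ℕ≈ν* : ∀ m x → m ×ℕ x ≈ ν m * x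
  ×ℕ≈ν* m x = begin
    m ×ℕ x           ≡⟨ ×ℕ≡× m x ⟩
    m × x            ≈⟨ ×-congʳ m (*-identityˡ x) ⟨
    m × (1# * x)     ≈⟨ ×-assoc-* m 1# x ⟨
    m × 1# * x       ≡⟨ ≡.cong (_* x) (≡.sym (×ℕ≡× m 1#)) ⟩
    ν m * x          ∎

  ×ℕ-neg : ∀ m x → m ×ℕ (- x) ≈ - (m ×ℕ x)
  ×ℕ-neg zero    x = sym -0#≈0#
  ×ℕ-neg (suc m) x = trans (+-congˡ (×ℕ-neg m x)) (-‿+-comm x (m ×ℕ x))

  ×ℕ-congʳ : ∀ m {x y} → x ≈ y → m ×ℕ x ≈ m ×ℕ y
  ×ℕ-congʳ zero    x≈y = refl
  ×ℕ-congʳ (suc m) x≈y = +-cong x≈y (×ℕ-congʳ m x≈y)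

  ^ℕ-congˡ : ∀ m {x y} → x ≈ y → x ^ℕ m ≈ y ^ℕ m
  ^ℕ-congˡ zero    x≈y = refl
  ^ℕ-congˡ (suc m) x≈y = *-cong x≈y (^ℕ-congˡ m x≈y)

  1^ℕ : ∀ m → 1# ^ℕ m ≈ 1#
  1^ℕ zero    = refl
  1^ℕ (suc m) = trans (*-identityˡ _) (1^ℕ m)

  sign : ℕ → Carrier
  sign zero    = 1#
  sign (suc k) = - sign k

  sign-+ : ∀ a b → sign (a ℕ.+ b) ≈ sign a * sign b
  sign-+ zero    b = sym (*-identityˡ _)
  sign-+ (suc a) b = trans (-‿cong (sign-+ a b)) (-‿distribˡ-* _ _)

  sign-sq : ∀ a → sign a * sign a ≈ 1#
  sign-sq zero    = *-identityˡ 1#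
  sign-sq (suc a) = begin
    - sign a * - sign a     ≈⟨ -‿distribˡ-* _ _ ⟨
    - (sign a * - sign a)   ≈⟨ -‿cong (-‿distribʳ-* _ _) ⟨
    - - (sign a * sign a)   ≈⟨ -‿involutive _ ⟩
    sign a * sign a         ≈⟨ sign-sq a ⟩
    1#                      ∎

  sign-∸ : ∀ N r → r ≤ N → sign (N ∸ r) ≈ sign N * sign r
  sign-∸ N r r≤N = begin
    sign (N ∸ r)                      ≈⟨ *-identityʳ _ ⟨
    sign (N ∸ r) * 1#                 ≈⟨ *-congˡ (sign-sq r) ⟨
    sign (N ∸ r) * (sign r * sign r)  ≈⟨ *-assoc _ _ _ ⟨
    sign (N ∸ r) * sign r * sign r    ≈⟨ *-congʳ (sign-+ (N ∸ r) r) ⟨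
    sign (N ∸ r ℕ.+ r) * sign r       ≡⟨ ≡.cong (λ k → sign k * sign r) (ℕP.m∸n+n≡m r≤N) ⟩
    sign N * sign r                   ∎

  neg^ℕ : ∀ x d → (- x) ^ℕ d ≈ sign d * x ^ℕ d
  neg^ℕ x zero    = sym (*-identityˡ 1#)
  neg^ℕ x (suc d) = begin
    - x * (- x) ^ℕ d          ≈⟨ *-congˡ (neg^ℕ x d) ⟩
    - x * (sign d * x ^ℕ d)   ≈⟨ -‿distribˡ-* _ _ ⟨
    - (x * (sign d * x ^ℕ d)) ≈⟨ -‿cong (x∙yz≈y∙xz x (sign d) _) ⟩
    - (sign d * (x * x ^ℕ d)) ≈⟨ -‿distribˡ-* _ _ ⟩
    - sign d * (x * x ^ℕ d)   ∎

  Σ : ℕ → (ℕ → Carrier) → Carrier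
  Σ zero    f = f 0
  Σ (suc k) f = Σ k f + f (suc k)

  Σ-cong≤ : ∀ k {f g : ℕ → Carrier} → (∀ i → i ≤ k → f i ≈ g i) → Σ k f ≈ Σ k g
  Σ-cong≤ zero    f≈g = f≈g 0 z≤n
  Σ-cong≤ (suc k) f≈g = +-cong (Σ-cong≤ k (λ i i≤k → f≈g i (ℕP.m≤n⇒m≤1+n i≤k))) (f≈g (suc k) ℕP.≤-refl)

  Σ-cong : ∀ k {f g : ℕ → Carrier} → (∀ i → f i ≈ g i) → Σ k f ≈ Σ k g
  Σ-cong k f≈g = Σ-cong≤ k (λ i _ → f≈g i)

  Σ-zero≤ : ∀ k {f : ℕ → Carrier} → (∀ i → i ≤ k → f i ≈ 0#) → Σ k f ≈ 0#
  Σ-zero≤ zero    f≈0 = f≈0 0 z≤n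
  Σ-zero≤ (suc k) f≈0 =
    trans (+-cong (Σ-zero≤ k (λ i i≤k → f≈0 i (ℕP.m≤n⇒m≤1+n i≤k))) (f≈0 (suc k) ℕP.≤-refl)) (+-identityˡ 0#)

  Σ-+ : ∀ k (f g : ℕ → Carrier) → Σ k (λ i → f i + g i) ≈ Σ k f + Σ k g
  Σ-+ zero    f g = refl
  Σ-+ (suc k) f g = trans (+-congʳ (Σ-+ k f g)) (+-interchange _ _ _ _)

  Σ-neg : ∀ k (f : ℕ → Carrier) → - Σ k f ≈ Σ k (λ i → - f i)
  Σ-neg zero    f = refl
  Σ-neg (suc k) f = trans (sym (-‿+-comm _ _)) (+-congʳ (Σ-neg k f))

  Σ-*ˡ : ∀ k x (f : ℕ → Carrier) → x * Σ k f ≈ Σ k (λ i → x * f i)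
  Σ-*ˡ zero    x f = refl
  Σ-*ˡ (suc k) x f = trans (distribˡ x _ _) (+-congʳ (Σ-*ˡ k x f))

  Σ-*ʳ : ∀ k x (f : ℕ → Carrier) → Σ k f * x ≈ Σ k (λ i → f i * x)
  Σ-*ʳ k x f = trans (*-comm _ _) (trans (Σ-*ˡ k x f) (Σ-cong k (λ i → *-comm _ _)))

  Σ-peel : ∀ k (f : ℕ → Carrier) → Σ (suc k) f ≈ f 0 + Σ k (f ∘ suc)
  Σ-peel zero    f = refl
  Σ-peel (suc k) f = trans (+-congʳ (Σ-peel k f)) (+-assoc _ _ _)

  Σ-split : ∀ a i (f : ℕ → Carrier) → Σ (a ℕ.+ suc i) f ≈ Σ a f + Σ i (λ r → f (a ℕ.+ suc r))
  Σ-split a zero    f rewrite ℕP.+-comm a 1 = refl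
  Σ-split a (suc i) f rewrite ℕP.+-suc a (suc i) =
    trans (+-congʳ (Σ-split a i f)) (+-assoc _ _ _)

  Σ-dropInitialZeros : ∀ a b {f : ℕ → Carrier} → (∀ i → i < a → f i ≈ 0#) →
                       Σ (a ℕ.+ b) f ≈ Σ b (λ r → f (a ℕ.+ r))
  Σ-dropInitialZeros zero    b f≈0 = refl
  Σ-dropInitialZeros (suc a) b f≈0 = begin
    Σ (suc (a ℕ.+ b)) _          ≈⟨ Σ-peel (a ℕ.+ b) _ ⟩
    _ + Σ (a ℕ.+ b) _            ≈⟨ +-cong (f≈0 0 (s≤s z≤n)) (Σ-dropInitialZeros a b (λ i i<a → f≈0 (suc i) (s≤s i<a))) ⟩
    0# + Σ b _                   ≈⟨ +-identityˡ _ ⟩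
    Σ b _                        ∎

  Σ-dropFinalZeros : ∀ a d {f : ℕ → Carrier} → (∀ i → a < i → f i ≈ 0#) → Σ (a ℕ.+ d) f ≈ Σ a f
  Σ-dropFinalZeros a zero    {f} f≈0 rewrite ℕP.+-identityʳ a = refl
  Σ-dropFinalZeros a (suc d) {f} f≈0 rewrite ℕP.+-suc a d =
    trans (+-cong (Σ-dropFinalZeros a d f≈0) (f≈0 (suc (a ℕ.+ d)) (s≤s (ℕP.m≤m+n a d)))) (+-identityʳ _)

  Σ-swap : ∀ a b (F : ℕ → ℕ → Carrier) → Σ a (λ i → Σ b (F i)) ≈ Σ b (λ j → Σ a (λ i → F i j))
  Σ-swap zero    b F = refl
  Σ-swap (suc a) b F = trans (+-congʳ (Σ-swap a b F)) (sym (Σ-+ b _ _))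

  Σ-reflect : ∀ k (f : ℕ → Carrier) → Σ k f ≈ Σ k (λ i → f (k ∸ i))
  Σ-reflect zero    f = refl
  Σ-reflect (suc k) f = begin
    Σ (suc k) f                         ≈⟨ Σ-peel k f ⟩
    f 0 + Σ k (f ∘ suc)                 ≈⟨ +-comm _ _ ⟩
    Σ k (f ∘ suc) + f 0                 ≈⟨ +-congʳ (Σ-reflect k (f ∘ suc)) ⟩
    Σ k (λ i → f (suc (k ∸ i))) + f 0   ≈⟨ +-cong (Σ-cong≤ k (λ i i≤k → reflexive (≡.cong f (≡.sym (ℕP.+-∸-assoc 1 i≤k)))))
                                                  (reflexive (≡.cong f (≡.sym (ℕP.n∸n≡0 k)))) ⟩
    Σ (suc k) (λ i → f (suc k ∸ i))     ∎

  sumFin≡sum : ∀ m (f : Fin m → Carrier) → sumFin m f ≡ sum f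
  sumFin≡sum zero    f = ≡.refl
  sumFin≡sum (suc m) f = ≡.cong (_+_ (f Fin.zero)) (sumFin≡sum m (f ∘ Fin.suc))

  sum-toℕ : ∀ n (g : ℕ → Carrier) → sum {suc n} (g ∘ toℕ) ≈ Σ n g
  sum-toℕ zero    g = +-identityʳ _
  sum-toℕ (suc n) g = trans (+-congˡ (sum-toℕ n (g ∘ suc))) (sym (Σ-peel n g))

  sum-single : ∀ m (f : Fin m → Carrier) k₀ → (∀ k → k ≢ k₀ → f k ≈ 0#) → sum f ≈ f k₀
  sum-single (suc m) f Fin.zero f≈0 =
    trans (+-congˡ (trans (sum-cong-≋ (λ k → f≈0 (Fin.suc k) λ ())) (sum-replicate-zero m))) (+-identityʳ _)
  sum-single (suc m) f (Fin.suc k₀) f≈0 =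
    trans (+-congʳ (f≈0 Fin.zero λ ()))
          (trans (+-identityˡ _) (sum-single m (f ∘ Fin.suc) k₀ (λ k k≢k₀ → f≈0 (Fin.suc k) (k≢k₀ ∘ FinP.suc-injective))))

  binomial : ∀ m x y → (x + y) ^ℕ m ≈ Σ m (λ r → (m C r) ×ℕ (x ^ℕ r * y ^ℕ (m ∸ r)))
  binomial m x y = begin
    (x + y) ^ℕ m                                 ≡⟨ ^ℕ≡^ (x + y) m ⟩
    (x + y) ^ m                                  ≈⟨ Binomial.theorem semiring x y (*-comm x y) m ⟩
    Binomial.binomialExpansion semiring x y m    ≈⟨ sum-toℕ m _ ⟩
    Σ m (λ r → (m C r) × (x ^ r * y ^ (m ∸ r)))  ≈⟨ Σ-cong m (λ r → reflexive (≡.sym (libraryTerm r))) ⟩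
    Σ m (λ r → (m C r) ×ℕ (x ^ℕ r * y ^ℕ (m ∸ r))) ∎
    where
    libraryTerm : ∀ r → (m C r) ×ℕ (x ^ℕ r * y ^ℕ (m ∸ r)) ≡ (m C r) × (x ^ r * y ^ (m ∸ r))
    libraryTerm r = ≡.trans (×ℕ≡× (m C r) _) (≡.cong₂ (λ u v → (m C r) × (u * v)) (^ℕ≡^ x r) (^ℕ≡^ y (m ∸ r)))

module IntegerPolynomials where
  open RingFacts ℤP.+-*-commutativeRing
  open Int using (_+_; _*_)
  open ≡.≡-Reasoning

  sumUpTo≡Σ : ∀ k f → sumUpTo k f ≡ Σ k f
  sumUpTo≡Σ zero    f = ≡.refl
  sumUpTo≡Σ (suc k) f = ≡.cong (_+ f (suc k)) (sumUpTo≡Σ k f)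

  ·P-Σ : ∀ f g k → (f ·P g) k ≡ Σ k (λ i → f i * g (k ∸ i))
  ·P-Σ f g k = sumUpTo≡Σ k (λ i → f i * g (k ∸ i))

  ·P-cong : ∀ {f f′ g g′} → f ≗ f′ → g ≗ g′ → f ·P g ≗ f′ ·P g′
  ·P-cong {f} {f′} {g} {g′} f≗f′ g≗g′ k = begin
    (f ·P g) k                       ≡⟨ ·P-Σ f g k ⟩
    Σ k (λ i → f i * g (k ∸ i))      ≡⟨ Σ-cong k (λ i → ≡.cong₂ _*_ (f≗f′ i) (g≗g′ (k ∸ i))) ⟩
    Σ k (λ i → f′ i * g′ (k ∸ i))    ≡⟨ ·P-Σ f′ g′ k ⟨
    (f′ ·P g′) k                     ∎

  oneP-·P : ∀ g → oneP ·P g ≗ g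
  oneP-·P g zero    = ℤP.*-identityˡ (g 0)
  oneP-·P g (suc k) = begin
    (oneP ·P g) (suc k)                          ≡⟨ ≡.trans (·P-Σ oneP g (suc k)) (Σ-peel k _) ⟩
    + 1 * g (suc k) + Σ k (λ i → + 0 * g (k ∸ i)) ≡⟨ ≡.cong₂ _+_ (ℤP.*-identityˡ (g (suc k))) (Σ-zero≤ k (λ i _ → ℤP.*-zeroˡ (g (k ∸ i)))) ⟩
    g (suc k) + + 0                              ≡⟨ ℤP.+-identityʳ _ ⟩
    g (suc k)                                    ∎

  -- Matrix of h(x) ↦ (-1)^n h(-1-x) on P_n; entry (j,p) = (-1)^(n+p) C(p,j).
  reflection : ℕ → ℕ → ℕ → ℤ
  reflection n j p = sign (n ℕ.+ p) * + (p C j)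

-- Reflection symmetry of n!·U_n (integer level).
module EulerReflection where
  open import Data.Integer.Tactic.RingSolver using (solve-∀)
  open RingFacts ℤP.+-*-commutativeRing
  open Ops ℤP.+-*-commutativeRing using (_×ℕ_; _^ℕ_)
  open Int using (_+_; _*_; -_; _-_)
  open ≡.≡-Reasoning
  open IntegerPolynomials

  sgn≡sign : ∀ k → sgn k ≡ sign k
  sgn≡sign zero          = ≡.refl
  sgn≡sign (suc zero)    = ≡.refl
  sgn≡sign (suc (suc k)) = ≡.trans (sgn≡sign k) (≡.sym (ℤP.neg-involutive (sign k)))

  ν≡+ : ∀ m → ν m ≡ + m
  ν≡+ zero    = ≡.refl
  ν≡+ (suc m) = ≡.trans (≡.cong (_+_ (+ 1)) (ν≡+ m)) (≡.sym (ℤP.pos-+ 1 m))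

  ×ℕ≡+* : ∀ m z → m ×ℕ z ≡ + m * z
  ×ℕ≡+* m z = ≡.trans (×ℕ≈ν* m z) (≡.cong (_* z) (ν≡+ m))

  oneMinusPow≡ : ∀ m i → oneMinusPow m i ≡ sign i * + (m C i)
  oneMinusPow≡ m i = ≡.cong (_* + (m C i)) (sgn≡sign i)

  oneMinusPow-pascal : ∀ m i → oneMinusPow (suc m) (suc i) ≡ oneMinusPow m (suc i) - oneMinusPow m i
  oneMinusPow-pascal m i
    rewrite oneMinusPow≡ (suc m) (suc i) | oneMinusPow≡ m (suc i) | oneMinusPow≡ m i
          | ≡.sym (nCk+nC[k+1]≡[n+1]C[k+1] m i) | ℤP.pos-+ (m C i) (m C suc i)
    = rearrange (sign i) (+ (m C i)) (+ (m C suc i))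
    where rearrange : ∀ s a b → (- s) * (a + b) ≡ (- s) * b - s * a
          rearrange = solve-∀

  oneMinusPow-vanish : ∀ m i → m < i → oneMinusPow m i ≡ + 0
  oneMinusPow-vanish m i m<i rewrite k>n⇒nCk≡0 m<i = ℤP.*-zeroʳ (sgn i)

  -- The backward difference Δh = (1-x)·h of a coefficient sequence.
  Δ : (ℕ → ℤ) → ℕ → ℤ
  Δ h zero    = h zero
  Δ h (suc k) = h (suc k) - h k

  Δ-cong : ∀ {g h} → g ≗ h → Δ g ≗ Δ h
  Δ-cong g≗h zero    = g≗h zero
  Δ-cong g≗h (suc k) = ≡.cong₂ _-_ (g≗h (suc k)) (g≗h k)

  oneMinusPow-zero-·P : ∀ g → oneMinusPow 0 ·P g ≗ g
  oneMinusPow-zero-·P g k = ≡.trans (·P-cong {g = g} {g′ = g} oneMinusPow0≗oneP (λ _ → ≡.refl) k) (oneP-·P g k)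
    where
    oneMinusPow0≗oneP : oneMinusPow 0 ≗ oneP
    oneMinusPow0≗oneP zero    = ≡.refl
    oneMinusPow0≗oneP (suc i) = oneMinusPow-vanish 0 (suc i) (s≤s z≤n)

  oneMinusPow-suc-·P : ∀ a g k → (oneMinusPow (suc a) ·P g) k ≡ Δ (oneMinusPow a ·P g) k
  oneMinusPow-suc-·P a g zero    = ≡.refl
  oneMinusPow-suc-·P a g (suc k) = begin
    (ω (suc a) ·P g) (suc k)                                   ≡⟨ ·P-Σ (ω (suc a)) g (suc k) ⟩
    Σ (suc k) (λ i → ω (suc a) i * g (suc k ∸ i))              ≡⟨ Σ-peel k _ ⟩
    ω a 0 * g (suc k) + Σ k (λ i → ω (suc a) (suc i) * g (k ∸ i))
      ≡⟨ ≡.cong (_+_ (ω a 0 * g (suc k))) (Σ-cong k (λ i → ≡.cong (_* g (k ∸ i)) (oneMinusPow-pascal a i))) ⟩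
    ω a 0 * g (suc k) + Σ k (λ i → (ω a (suc i) - ω a i) * g (k ∸ i))
      ≡⟨ ≡.cong (_+_ (ω a 0 * g (suc k))) (Σ-cong k (λ i → expand (ω a (suc i)) (ω a i) (g (k ∸ i)))) ⟩
    ω a 0 * g (suc k) + Σ k (λ i → ω a (suc i) * g (k ∸ i) + - (ω a i * g (k ∸ i)))
      ≡⟨ ≡.cong (_+_ (ω a 0 * g (suc k))) (≡.trans (Σ-+ k _ _) (≡.cong (_+_ (Σ k (λ i → ω a (suc i) * g (k ∸ i)))) (≡.sym (Σ-neg k _)))) ⟩
    ω a 0 * g (suc k) + (Σ k (λ i → ω a (suc i) * g (k ∸ i)) - Σ k (λ i → ω a i * g (k ∸ i)))
      ≡⟨ ℤP.+-assoc (ω a 0 * g (suc k)) (Σ k (λ i → ω a (suc i) * g (k ∸ i))) (- Σ k (λ i → ω a i * g (k ∸ i))) ⟨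
    (ω a 0 * g (suc k) + Σ k (λ i → ω a (suc i) * g (k ∸ i))) - Σ k (λ i → ω a i * g (k ∸ i))
      ≡⟨ ≡.cong₂ _-_ (≡.sym (≡.trans (·P-Σ (ω a) g (suc k)) (Σ-peel k _))) (≡.sym (·P-Σ (ω a) g k)) ⟩
    Δ (ω a ·P g) (suc k)                                       ∎
    where
    ω = oneMinusPow
    expand : ∀ x y z → (x - y) * z ≡ x * z + - (y * z)
    expand = solve-∀

  oneMinusPow-·P-assoc : ∀ a b h k → (oneMinusPow a ·P (oneMinusPow b ·P h)) k ≡ (oneMinusPow (a ℕ.+ b) ·P h) k
  oneMinusPow-·P-assoc zero    b h k = oneMinusPow-zero-·P (oneMinusPow b ·P h) k
  oneMinusPow-·P-assoc (suc a) b h k = begin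
    (oneMinusPow (suc a) ·P (oneMinusPow b ·P h)) k   ≡⟨ oneMinusPow-suc-·P a (oneMinusPow b ·P h) k ⟩
    Δ (oneMinusPow a ·P (oneMinusPow b ·P h)) k       ≡⟨ Δ-cong (oneMinusPow-·P-assoc a b h) k ⟩
    Δ (oneMinusPow (a ℕ.+ b) ·P h) k                  ≡⟨ oneMinusPow-suc-·P (a ℕ.+ b) h k ⟨
    (oneMinusPow (suc a ℕ.+ b) ·P h) k                ∎

  -- Closed form of the entries of n!·U_n: since (1-x)^(n-p) (1-x)^(p+1) = (1-x)^(n+1),
  -- the coefficient of x^i in (1-x)^(n-p) A_p(x) is Σ_{t ≤ i} (-1)^t C(n+1,t) (i-t)^p.
  nfactU-closedForm : ∀ n p i → p ≤ n → nfactU n p i ≡ Σ i (λ t → oneMinusPow (suc n) t * + ((i ∸ t) ℕ.^ p))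
  nfactU-closedForm n p i p≤n = begin
    (oneMinusPow (n ∸ p) ·P (oneMinusPow (suc p) ·P powers)) i   ≡⟨ oneMinusPow-·P-assoc (n ∸ p) (suc p) powers i ⟩
    (oneMinusPow (n ∸ p ℕ.+ suc p) ·P powers) i                  ≡⟨ ≡.cong (λ m → (oneMinusPow m ·P powers) i) exponent ⟩
    (oneMinusPow (suc n) ·P powers) i                             ≡⟨ ·P-Σ (oneMinusPow (suc n)) powers i ⟩
    Σ i (λ t → oneMinusPow (suc n) t * + ((i ∸ t) ℕ.^ p))        ∎
    where
    powers : ℕ → ℤ
    powers j = + (j ℕ.^ p)
    exponent : n ∸ p ℕ.+ suc p ≡ suc n
    exponent = ≡.trans (ℕP.+-suc (n ∸ p) p) (≡.cong suc (ℕP.m∸n+n≡m p≤n))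

  oneMinusPow-byParts : ∀ N (G : ℕ → ℤ) →
    Σ (suc N) (λ t → oneMinusPow (suc N) t * G t) ≡ Σ N (λ t → oneMinusPow N t * (G t - G (suc t)))
  oneMinusPow-byParts N G = begin
    Σ (suc N) (λ t → ω (suc N) t * G t)
      ≡⟨ Σ-peel N _ ⟩
    ω N 0 * G 0 + Σ N (λ t → ω (suc N) (suc t) * G (suc t))
      ≡⟨ ≡.cong (_+_ (ω N 0 * G 0)) (Σ-cong N (λ t → ≡.cong (_* G (suc t)) (oneMinusPow-pascal N t))) ⟩
    ω N 0 * G 0 + Σ N (λ t → (ω N (suc t) - ω N t) * G (suc t))
      ≡⟨ ≡.cong (_+_ (ω N 0 * G 0)) (Σ-cong N (λ t → expand (ω N (suc t)) (ω N t) (G (suc t)))) ⟩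
    ω N 0 * G 0 + Σ N (λ t → ω N (suc t) * G (suc t) + - (ω N t * G (suc t)))
      ≡⟨ ≡.cong (_+_ (ω N 0 * G 0)) (Σ-+ N _ _) ⟩
    ω N 0 * G 0 + (Σ N (λ t → ω N (suc t) * G (suc t)) + Σ N (λ t → - (ω N t * G (suc t))))
      ≡⟨ ℤP.+-assoc (ω N 0 * G 0) _ _ ⟨
    ω N 0 * G 0 + Σ N (λ t → ω N (suc t) * G (suc t)) + Σ N (λ t → - (ω N t * G (suc t)))
      ≡⟨ ≡.cong (_+ Σ N (λ t → - (ω N t * G (suc t)))) (≡.sym (Σ-peel N (λ t → ω N t * G t))) ⟩
    Σ N (λ t → ω N t * G t) + ω N (suc N) * G (suc N) + Σ N (λ t → - (ω N t * G (suc t)))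
      ≡⟨ ≡.cong (λ z → Σ N (λ t → ω N t * G t) + z + Σ N (λ t → - (ω N t * G (suc t)))) lastTerm ⟩
    Σ N (λ t → ω N t * G t) + + 0 + Σ N (λ t → - (ω N t * G (suc t)))
      ≡⟨ ≡.cong (_+ Σ N (λ t → - (ω N t * G (suc t)))) (ℤP.+-identityʳ (Σ N (λ t → ω N t * G t))) ⟩
    Σ N (λ t → ω N t * G t) + Σ N (λ t → - (ω N t * G (suc t)))
      ≡⟨ Σ-+ N _ _ ⟨
    Σ N (λ t → ω N t * G t + - (ω N t * G (suc t)))
      ≡⟨ Σ-cong N (λ t → factor (ω N t) (G t) (G (suc t))) ⟩
    Σ N (λ t → ω N t * (G t - G (suc t))) ∎
    where
    ω = oneMinusPow
    expand : ∀ x y z → (x - y) * z ≡ x * z + - (y * z)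
    expand = solve-∀
    lastTerm : ω N (suc N) * G (suc N) ≡ + 0
    lastTerm = ≡.trans (≡.cong (_* G (suc N)) (oneMinusPow-vanish N (suc N) ℕP.≤-refl)) (ℤP.*-zeroˡ (G (suc N)))
    factor : ∀ o a b → o * a + - (o * b) ≡ o * (a - b)
    factor = solve-∀

  binomial-difference : ∀ q y → (y + + 1) ^ℕ suc q - y ^ℕ suc q ≡ Σ q (λ r → + (suc q C r) * y ^ℕ r)
  binomial-difference q y = begin
    (y + + 1) ^ℕ suc q - y ^ℕ suc q              ≡⟨ ≡.cong (_- y ^ℕ suc q) (binomial (suc q) y (+ 1)) ⟩
    (Σ q term + term (suc q)) - y ^ℕ suc q       ≡⟨ ≡.cong (λ z → (Σ q term + z) - y ^ℕ suc q) lastTerm ⟩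
    (Σ q term + + 1 * y ^ℕ suc q) - y ^ℕ suc q   ≡⟨ cancel (Σ q term) (y ^ℕ suc q) ⟩
    Σ q term                                     ≡⟨ Σ-cong q termAt ⟩
    Σ q (λ r → + (suc q C r) * y ^ℕ r)           ∎
    where
    term : ℕ → ℤ
    term r = (suc q C r) ×ℕ (y ^ℕ r * (+ 1) ^ℕ (suc q ∸ r))
    termAt : ∀ r → term r ≡ + (suc q C r) * y ^ℕ r
    termAt r = ≡.trans (×ℕ≡+* (suc q C r) _)
                       (≡.cong (λ z → + (suc q C r) * z) (≡.trans (≡.cong (y ^ℕ r *_) (1^ℕ (suc q ∸ r))) (ℤP.*-identityʳ _)))
    lastTerm : term (suc q) ≡ + 1 * y ^ℕ suc q
    lastTerm = ≡.trans (termAt (suc q)) (≡.cong (λ c → + c * y ^ℕ suc q) (nCn≡1 (suc q)))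
    cancel : ∀ a b → (a + + 1 * b) - b ≡ a
    cancel = solve-∀

  power-difference : ∀ q m t →
    (m - + t) ^ℕ suc q - (m - + suc t) ^ℕ suc q ≡ Σ q (λ r → + (suc q C r) * (m - + 1 - + t) ^ℕ r)
  power-difference q m t = begin
    (m - + t) ^ℕ suc q - (m - + suc t) ^ℕ suc q
      ≡⟨ ≡.cong₂ (λ a b → a ^ℕ suc q - b ^ℕ suc q) (shiftUp m (+ t))
                 (≡.trans (≡.cong (_-_ m) (ℤP.pos-+ 1 t)) (shiftDown m (+ t))) ⟩
    (m - + 1 - + t + + 1) ^ℕ suc q - (m - + 1 - + t) ^ℕ suc q
      ≡⟨ binomial-difference q (m - + 1 - + t) ⟩
    Σ q (λ r → + (suc q C r) * (m - + 1 - + t) ^ℕ r) ∎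
    where
    shiftUp : ∀ m u → m - u ≡ (m - + 1 - u) + + 1
    shiftUp = solve-∀
    shiftDown : ∀ m u → m - (+ 1 + u) ≡ m - + 1 - u
    shiftDown = solve-∀

  -- The N-th finite difference of a polynomial of degree p < N vanishes:
  -- Σ_{t ≤ N} (-1)^t C(N,t) (m - t)^p = 0.  By parts, the case (N+1, q+1)
  -- reduces to the cases (N, r) for r ≤ q.
  finiteDifference-vanish : ∀ N p → p < N → ∀ m → Σ N (λ t → oneMinusPow N t * (m - + t) ^ℕ p) ≡ + 0
  finiteDifference-vanish (suc N) zero    _         m = begin
    Σ (suc N) (λ t → oneMinusPow (suc N) t * + 1)     ≡⟨ oneMinusPow-byParts N (λ _ → + 1) ⟩
    Σ N (λ t → oneMinusPow N t * + 0)                 ≡⟨ Σ-zero≤ N (λ t _ → ℤP.*-zeroʳ (oneMinusPow N t)) ⟩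
    + 0                                               ∎
  finiteDifference-vanish (suc N) (suc q) (s≤s q<N) m = begin
    Σ (suc N) (λ t → ω (suc N) t * (m - + t) ^ℕ suc q)
      ≡⟨ oneMinusPow-byParts N (λ t → (m - + t) ^ℕ suc q) ⟩
    Σ N (λ t → ω N t * ((m - + t) ^ℕ suc q - (m - + suc t) ^ℕ suc q))
      ≡⟨ Σ-cong N (λ t → ≡.cong (ω N t *_) (power-difference q m t)) ⟩
    Σ N (λ t → ω N t * Σ q (λ r → c r * y t ^ℕ r))
      ≡⟨ Σ-cong N (λ t → ≡.trans (Σ-*ˡ q (ω N t) _) (Σ-cong q (λ r → swapFactors (ω N t) (c r) (y t ^ℕ r)))) ⟩
    Σ N (λ t → Σ q (λ r → c r * (ω N t * y t ^ℕ r)))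
      ≡⟨ Σ-swap N q _ ⟩
    Σ q (λ r → Σ N (λ t → c r * (ω N t * y t ^ℕ r)))
      ≡⟨ Σ-cong q (λ r → ≡.sym (Σ-*ˡ N (c r) _)) ⟩
    Σ q (λ r → c r * Σ N (λ t → ω N t * y t ^ℕ r))
      ≡⟨ Σ-zero≤ q (λ r r≤q → ≡.trans (≡.cong (c r *_) (finiteDifference-vanish N r (ℕP.≤-<-trans r≤q q<N) (m - + 1)))
                                      (ℤP.*-zeroʳ (c r))) ⟩
    + 0 ∎
    where
    ω = oneMinusPow
    c : ℕ → ℤ
    c r = + (suc q C r)
    y : ℕ → ℤ
    y t = m - + 1 - + t
    swapFactors : ∀ o a b → o * (a * b) ≡ a * (o * b)
    swapFactors = solve-∀

  pos-^ : ∀ a k → + (a ℕ.^ k) ≡ (+ a) ^ℕ k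
  pos-^ a zero    = ≡.refl
  pos-^ a (suc k) = ≡.trans (ℤP.pos-* a (a ℕ.^ k)) (≡.cong (+ a *_) (pos-^ a k))

  pos-∸ : ∀ a t → t ≤ a → + (a ∸ t) ≡ + a - + t
  pos-∸ a t t≤a = ≡.sym (≡.trans (ℤP.m-n≡m⊖n a t) (ℤP.⊖-≥ t≤a))

  oneMinusPow-reflect : ∀ N r → r ≤ N → oneMinusPow N (N ∸ r) ≡ sign N * oneMinusPow N r
  oneMinusPow-reflect N r r≤N = begin
    oneMinusPow N (N ∸ r)               ≡⟨ oneMinusPow≡ N (N ∸ r) ⟩
    sign (N ∸ r) * + (N C (N ∸ r))      ≡⟨ ≡.cong₂ (λ s c → s * + c) (sign-∸ N r r≤N) (≡.sym (nCk≡nC[n∸k] r≤N)) ⟩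
    sign N * sign r * + (N C r)         ≡⟨ ℤP.*-assoc (sign N) (sign r) _ ⟩
    sign N * (sign r * + (N C r))       ≡⟨ ≡.cong (sign N *_) (oneMinusPow≡ N r) ⟨
    sign N * oneMinusPow N r            ∎

  binomial-truncated : ∀ n p y → p ≤ n → Σ n (λ j → + (p C j) * y ^ℕ j) ≡ (y + + 1) ^ℕ p
  binomial-truncated n p y p≤n = begin
    Σ n term                     ≡⟨ ≡.cong (λ k → Σ k term) (ℕP.m+[n∸m]≡n p≤n) ⟨
    Σ (p ℕ.+ (n ∸ p)) term       ≡⟨ Σ-dropFinalZeros p (n ∸ p) (λ j p<j → ≡.trans (≡.cong (λ c → + c * y ^ℕ j) (k>n⇒nCk≡0 p<j)) (ℤP.*-zeroˡ (y ^ℕ j))) ⟩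
    Σ p term                     ≡⟨ Σ-cong p binomialTerm ⟨
    Σ p (λ r → (p C r) ×ℕ (y ^ℕ r * (+ 1) ^ℕ (p ∸ r)))   ≡⟨ binomial p y (+ 1) ⟨
    (y + + 1) ^ℕ p               ∎
    where
    term : ℕ → ℤ
    term j = + (p C j) * y ^ℕ j
    binomialTerm : ∀ r → (p C r) ×ℕ (y ^ℕ r * (+ 1) ^ℕ (p ∸ r)) ≡ term r
    binomialTerm r = ≡.trans (×ℕ≡+* (p C r) _) (≡.cong (+ (p C r) *_) (≡.trans (≡.cong (y ^ℕ r *_) (1^ℕ (p ∸ r))) (ℤP.*-identityʳ _)))

  nfactU-times-reflection : ∀ n i p → p ≤ n →
    Σ n (λ j → nfactU n j i * reflection n j p) ≡ sign (n ℕ.+ p) * Σ i (λ t → oneMinusPow (suc n) t * (+ (i ∸ t) + + 1) ^ℕ p)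
  nfactU-times-reflection n i p p≤n = begin
    Σ n (λ j → nfactU n j i * (s * c j))
      ≡⟨ Σ-cong≤ n (λ j j≤n → ≡.cong (_* (s * c j)) (≡.trans (nfactU-closedForm n j i j≤n) (Σ-cong i (λ t → ≡.cong (o t *_) (pos-^ (i ∸ t) j))))) ⟩
    Σ n (λ j → Σ i (λ t → o t * y t ^ℕ j) * (s * c j))
      ≡⟨ Σ-cong n (λ j → ≡.trans (Σ-*ʳ i (s * c j) _) (Σ-cong i (λ t → rearrange (o t) (y t ^ℕ j) s (c j)))) ⟩
    Σ n (λ j → Σ i (λ t → s * (o t * (c j * y t ^ℕ j))))
      ≡⟨ Σ-swap n i _ ⟩
    Σ i (λ t → Σ n (λ j → s * (o t * (c j * y t ^ℕ j))))
      ≡⟨ Σ-cong i (λ t → ≡.trans (≡.sym (Σ-*ˡ n s _)) (≡.cong (s *_) (≡.sym (Σ-*ˡ n (o t) _)))) ⟩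
    Σ i (λ t → s * (o t * Σ n (λ j → c j * y t ^ℕ j)))
      ≡⟨ Σ-cong i (λ t → ≡.cong (λ z → s * (o t * z)) (binomial-truncated n p (y t) p≤n)) ⟩
    Σ i (λ t → s * (o t * (y t + + 1) ^ℕ p))
      ≡⟨ Σ-*ˡ i s _ ⟨
    s * Σ i (λ t → o t * (y t + + 1) ^ℕ p) ∎
    where
    o = oneMinusPow (suc n)
    s = sign (n ℕ.+ p)
    c : ℕ → ℤ
    c j = + (p C j)
    y : ℕ → ℤ
    y t = + (i ∸ t)
    rearrange : ∀ a b s c → a * b * (s * c) ≡ s * (a * (c * b))
    rearrange = solve-∀

  vanishingSum-tailTerm : ∀ n i p r → i ≤ n → r ≤ i →
    oneMinusPow (suc n) (n ∸ i ℕ.+ suc (i ∸ r)) * (+ (n ∸ i) - + (n ∸ i ℕ.+ suc (i ∸ r))) ^ℕ p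
      ≡ sign (suc n) * sign p * (oneMinusPow (suc n) r * (+ (i ∸ r) + + 1) ^ℕ p)
  vanishingSum-tailTerm n i p r i≤n r≤i = begin
    o (a ℕ.+ suc (i ∸ r)) * (+ a - + (a ℕ.+ suc (i ∸ r))) ^ℕ p
      ≡⟨ ≡.cong₂ (λ k b → o k * b ^ℕ p) index base ⟩
    o (suc n ∸ r) * (- (+ (i ∸ r) + + 1)) ^ℕ p
      ≡⟨ ≡.cong₂ _*_ (oneMinusPow-reflect (suc n) r (ℕP.m≤n⇒m≤1+n (ℕP.≤-trans r≤i i≤n))) (neg^ℕ _ p) ⟩
    (sign (suc n) * o r) * (sign p * (+ (i ∸ r) + + 1) ^ℕ p)
      ≡⟨ interchange (sign (suc n)) (o r) (sign p) _ ⟩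
    sign (suc n) * sign p * (o r * (+ (i ∸ r) + + 1) ^ℕ p) ∎
    where
    a = n ∸ i
    o = oneMinusPow (suc n)
    index : a ℕ.+ suc (i ∸ r) ≡ suc n ∸ r
    index = begin
      a ℕ.+ suc (i ∸ r)   ≡⟨ ℕP.+-suc a (i ∸ r) ⟩
      suc (a ℕ.+ (i ∸ r)) ≡⟨ ≡.cong suc (ℕP.+-∸-assoc a r≤i) ⟨
      suc (a ℕ.+ i ∸ r)   ≡⟨ ≡.cong (λ k → suc (k ∸ r)) (ℕP.m∸n+n≡m i≤n) ⟩
      suc (n ∸ r)         ≡⟨ ℕP.+-∸-assoc 1 (ℕP.≤-trans r≤i i≤n) ⟨
      suc n ∸ r           ∎
    base : + a - + (a ℕ.+ suc (i ∸ r)) ≡ - (+ (i ∸ r) + + 1)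
    base rewrite ℤP.pos-+ a (suc (i ∸ r)) | ℤP.pos-+ 1 (i ∸ r) = simplify (+ a) (+ (i ∸ r))
      where simplify : ∀ a k → a - (a + (+ 1 + k)) ≡ - (k + + 1)
            simplify = solve-∀
    interchange : ∀ a b c d → (a * b) * (c * d) ≡ (a * c) * (b * d)
    interchange = solve-∀

  -- The vanishing sum Σ_{t ≤ n+1} (-1)^t C(n+1,t) (a-t)^p, a = n-i, p ≤ n, splits
  -- at t = a; its tail is (-1)^(n+1+p) times the sum in nfactU-times-reflection.
  vanishingSum-split : ∀ n i p → i ≤ n → p ≤ n →
    Σ (n ∸ i) (λ t → oneMinusPow (suc n) t * (+ (n ∸ i) - + t) ^ℕ p)
      + sign (suc n) * sign p * Σ i (λ t → oneMinusPow (suc n) t * (+ (i ∸ t) + + 1) ^ℕ p) ≡ + 0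
  vanishingSum-split n i p i≤n p≤n = begin
    Σ a f + σ * Σ i (λ r → o r * (+ (i ∸ r) + + 1) ^ℕ p)
      ≡⟨ ≡.cong (_+_ (Σ a f)) (≡.trans (Σ-*ˡ i σ _) (≡.sym (Σ-cong≤ i (λ r → vanishingSum-tailTerm n i p r i≤n)))) ⟩
    Σ a f + Σ i (λ r → f (a ℕ.+ suc (i ∸ r)))  ≡⟨ ≡.cong (_+_ (Σ a f)) (Σ-reflect i (λ r → f (a ℕ.+ suc r))) ⟨
    Σ a f + Σ i (λ r → f (a ℕ.+ suc r))        ≡⟨ Σ-split a i f ⟨
    Σ (a ℕ.+ suc i) f                          ≡⟨ ≡.cong (λ k → Σ k f) a+i+1≡n+1 ⟩
    Σ (suc n) f                                ≡⟨ finiteDifference-vanish (suc n) p (s≤s p≤n) (+ a) ⟩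
    + 0                                        ∎
    where
    a = n ∸ i
    o = oneMinusPow (suc n)
    σ = sign (suc n) * sign p
    f : ℕ → ℤ
    f t = o t * (+ a - + t) ^ℕ p
    a+i+1≡n+1 : a ℕ.+ suc i ≡ suc n
    a+i+1≡n+1 = ≡.trans (ℕP.+-suc a i) (≡.cong suc (ℕP.m∸n+n≡m i≤n))

  nfactU-reflection : ∀ n i p → i ≤ n → p ≤ n →
    nfactU n p (n ∸ i) ≡ Σ n (λ j → nfactU n j i * reflection n j p)
  nfactU-reflection n i p i≤n p≤n = begin
    nfactU n p a                         ≡⟨ nfactU-closedForm n p a p≤n ⟩
    Σ a (λ t → o t * + ((a ∸ t) ℕ.^ p))  ≡⟨ Σ-cong≤ a (λ t t≤a → ≡.cong (o t *_) (≡.trans (pos-^ (a ∸ t) p) (≡.cong (_^ℕ p) (pos-∸ a t t≤a)))) ⟩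
    Σ a f                                ≡⟨ x+y≡0⇒x≡-y (Σ a f) (σ * X) (vanishingSum-split n i p i≤n p≤n) ⟩
    - (σ * X)                            ≡⟨ ≡.cong (λ z → - (z * X)) σ≡-s ⟩
    - (- s * X)                          ≡⟨ negNeg s X ⟩
    s * X                                ≡⟨ nfactU-times-reflection n i p p≤n ⟨
    Σ n (λ j → nfactU n j i * reflection n j p) ∎
    where
    a = n ∸ i
    o = oneMinusPow (suc n)
    s = sign (n ℕ.+ p)
    σ = sign (suc n) * sign p
    f : ℕ → ℤ
    f t = o t * (+ a - + t) ^ℕ p
    X = Σ i (λ t → o t * (+ (i ∸ t) + + 1) ^ℕ p)
    σ≡-s : σ ≡ - s
    σ≡-s = ≡.sym (sign-+ (suc n) p)
    x+y≡0⇒x≡-y : ∀ x y → x + y ≡ + 0 → x ≡ - y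
    x+y≡0⇒x≡-y x y x+y≡0 = ≡.trans (split x y) (≡.trans (≡.cong (_- y) x+y≡0) (ℤP.+-identityˡ (- y)))
      where split : ∀ x y → x ≡ (x + y) - y
            split = solve-∀
    negNeg : ∀ s x → - (- s * x) ≡ s * x
    negNeg = solve-∀

-- Reflection symmetry of U_n^{-1} (integer level).
module FactorialReflection where
  open import Data.Integer.Tactic.RingSolver using (solve-∀)
  open RingFacts ℤP.+-*-commutativeRing
  open IntegerPolynomials
  open Int using (_+_; _*_; -_; _-_)
  open ≡.≡-Reasoning

  mulLin-cong : ∀ a {f g} → f ≗ g → mulLin a f ≗ mulLin a g
  mulLin-cong a f≗g zero    = ≡.cong (a *_) (f≗g 0)
  mulLin-cong a f≗g (suc k) = ≡.cong₂ (λ u v → u + a * v) (f≗g k) (f≗g (suc k))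

  mulLin-·P : ∀ a f g → (mulLin a f ·P g) ≗ mulLin a (f ·P g)
  mulLin-·P a f g zero    = ℤP.*-assoc a (f 0) (g 0)
  mulLin-·P a f g (suc k) = begin
    (mulLin a f ·P g) (suc k)
      ≡⟨ ≡.trans (·P-Σ (mulLin a f) g (suc k)) (Σ-peel k _) ⟩
    a * f 0 * g (suc k) + Σ k (λ i → (f i + a * f (suc i)) * g (k ∸ i))
      ≡⟨ ≡.cong (_+_ (a * f 0 * g (suc k))) (≡.trans (Σ-cong k (λ i → expand (f i) a (f (suc i)) (g (k ∸ i)))) (Σ-+ k _ _)) ⟩
    a * f 0 * g (suc k) + (Σ k (λ i → f i * g (k ∸ i)) + Σ k (λ i → a * (f (suc i) * g (k ∸ i))))
      ≡⟨ ≡.cong (λ z → a * f 0 * g (suc k) + (Σ k (λ i → f i * g (k ∸ i)) + z)) (Σ-*ˡ k a _) ⟨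
    a * f 0 * g (suc k) + (Σ k (λ i → f i * g (k ∸ i)) + a * Σ k (λ i → f (suc i) * g (k ∸ i)))
      ≡⟨ regroup a (f 0) (g (suc k)) (Σ k (λ i → f i * g (k ∸ i))) (Σ k (λ i → f (suc i) * g (k ∸ i))) ⟩
    Σ k (λ i → f i * g (k ∸ i)) + a * (f 0 * g (suc k) + Σ k (λ i → f (suc i) * g (k ∸ i)))
      ≡⟨ ≡.cong₂ (λ u v → u + a * v) (≡.sym (·P-Σ f g k)) (≡.sym (≡.trans (·P-Σ f g (suc k)) (Σ-peel k _))) ⟩
    mulLin a (f ·P g) (suc k) ∎
    where
    expand : ∀ x a y z → (x + a * y) * z ≡ x * z + a * (y * z)
    expand = solve-∀
    regroup : ∀ a b b′ c d → a * b * b′ + (c + a * d) ≡ c + a * (b * b′ + d)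
    regroup = solve-∀

  mulLin-comm : ∀ a b h → mulLin a (mulLin b h) ≗ mulLin b (mulLin a h)
  mulLin-comm a b h zero                = swap a b (h 0)
    where swap : ∀ a b x → a * (b * x) ≡ b * (a * x)
          swap = solve-∀
  mulLin-comm a b h (suc zero)          = swap a b (h 0) (h 1)
    where swap : ∀ a b x y → b * x + a * (x + b * y) ≡ a * x + b * (x + a * y)
          swap = solve-∀
  mulLin-comm a b h (suc (suc k))       = swap a b (h k) (h (suc k)) (h (suc (suc k)))
    where swap : ∀ a b x y z → (x + b * y) + a * (y + b * z) ≡ (x + a * y) + b * (y + a * z)
          swap = solve-∀

  scale : ℤ → (ℕ → ℤ) → ℕ → ℤ
  scale c h k = c * h k

  mulLin-scale : ∀ a c h → mulLin a (scale c h) ≗ scale c (mulLin a h)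
  mulLin-scale a c h zero    = swap a c (h 0)
    where swap : ∀ a c x → a * (c * x) ≡ c * (a * x)
          swap = solve-∀
  mulLin-scale a c h (suc k) = factor a c (h k) (h (suc k))
    where factor : ∀ a c x y → c * x + a * (c * y) ≡ c * (x + a * y)
          factor = solve-∀

  DegreeAtMost : ℕ → (ℕ → ℤ) → Set
  DegreeAtMost N h = ∀ j → N < j → h j ≡ + 0

  oneP-degree : DegreeAtMost 0 oneP
  oneP-degree (suc j) _ = ≡.refl

  mulLin-degree : ∀ N a h → DegreeAtMost N h → DegreeAtMost (suc N) (mulLin a h)
  mulLin-degree N a h deg (suc j) (s≤s N<j)
    rewrite deg j N<j | deg (suc j) (ℕP.m<n⇒m<1+n N<j) = ≡.trans (ℤP.+-identityˡ _) (ℤP.*-zeroʳ a)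

  linearProduct : (ℕ → ℤ) → ℕ → (ℕ → ℤ) → ℕ → ℤ
  linearProduct c zero    h = h
  linearProduct c (suc p) h = mulLin (c p) (linearProduct c p h)

  linearProduct-cong : ∀ {c d} → (∀ k → c k ≡ d k) → ∀ p {g h} → g ≗ h → linearProduct c p g ≗ linearProduct d p h
  linearProduct-cong c≡d zero    g≗h = g≗h
  linearProduct-cong c≡d (suc p) g≗h k =
    ≡.trans (≡.cong (λ a → mulLin a _ k) (c≡d p)) (mulLin-cong _ (linearProduct-cong c≡d p g≗h) k)

  linearProduct-·P : ∀ c p f g → (linearProduct c p f ·P g) ≗ linearProduct c p (f ·P g)
  linearProduct-·P c zero    f g k = ≡.refl
  linearProduct-·P c (suc p) f g k =
    ≡.trans (mulLin-·P (c p) (linearProduct c p f) g k) (mulLin-cong (c p) (linearProduct-·P c p f g) k)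

  mulLin-linearProduct : ∀ a c p h → mulLin a (linearProduct c p h) ≗ linearProduct c p (mulLin a h)
  mulLin-linearProduct a c zero    h k = ≡.refl
  mulLin-linearProduct a c (suc p) h k =
    ≡.trans (mulLin-comm a (c p) (linearProduct c p h) k) (mulLin-cong (c p) (mulLin-linearProduct a c p h) k)

  linearProduct-comm : ∀ c p d q h → linearProduct c p (linearProduct d q h) ≗ linearProduct d q (linearProduct c p h)
  linearProduct-comm c zero    d q h k = ≡.refl
  linearProduct-comm c (suc p) d q h k =
    ≡.trans (mulLin-cong (c p) (linearProduct-comm c p d q h) k) (mulLin-linearProduct (c p) d q (linearProduct c p h) k)

  linearProduct-scale : ∀ c p s h → linearProduct c p (scale s h) ≗ scale s (linearProduct c p h)
  linearProduct-scale c zero    s h k = ≡.refl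
  linearProduct-scale c (suc p) s h k =
    ≡.trans (mulLin-cong (c p) (linearProduct-scale c p s h) k) (mulLin-scale (c p) s (linearProduct c p h) k)

  linearProduct-degree : ∀ c p M h → DegreeAtMost M h → DegreeAtMost (p ℕ.+ M) (linearProduct c p h)
  linearProduct-degree c zero    M h deg = deg
  linearProduct-degree c (suc p) M h deg = mulLin-degree (p ℕ.+ M) (c p) _ (linearProduct-degree c p M h deg)

  fallingRoots risingRoots : ℕ → ℤ
  fallingRoots k = - + k
  risingRoots  k = + suc k

  falling′ rising′ : ℕ → ℕ → ℤ
  falling′ p = linearProduct fallingRoots p oneP
  rising′  q = linearProduct risingRoots q oneP

  falling≗ : ∀ p → falling p ≗ falling′ p
  falling≗ zero    k = ≡.refl
  falling≗ (suc p) k = mulLin-cong _ (falling≗ p) k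

  rising1≗ : ∀ q → rising1 q ≗ rising′ q
  rising1≗ zero    k = ≡.refl
  rising1≗ (suc q) k = mulLin-cong _ (rising1≗ q) k

  Uinv≗ : ∀ n p → Uinv n p ≗ linearProduct fallingRoots p (rising′ (n ∸ p))
  Uinv≗ n p k = begin
    (falling p ·P rising1 (n ∸ p)) k                    ≡⟨ ·P-cong (falling≗ p) (rising1≗ (n ∸ p)) k ⟩
    (falling′ p ·P rising′ (n ∸ p)) k                   ≡⟨ linearProduct-·P fallingRoots p oneP (rising′ (n ∸ p)) k ⟩
    linearProduct fallingRoots p (oneP ·P rising′ (n ∸ p)) k ≡⟨ linearProduct-cong (λ _ → ≡.refl) p (oneP-·P (rising′ (n ∸ p))) k ⟩
    linearProduct fallingRoots p (rising′ (n ∸ p)) k   ∎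

  -- Coefficients of h(-1-x) for h of degree at most N:
  -- (reflectPoly N h)_l = Σ_{j ≤ N} (-1)^j C(j,l) h_j.
  reflectWeight : ℕ → ℕ → ℤ
  reflectWeight j l = sign j * + (j C l)

  reflectPoly : ℕ → (ℕ → ℤ) → ℕ → ℤ
  reflectPoly N h l = Σ N (λ j → reflectWeight j l * h j)

  reflectPoly-cong : ∀ N {g h} → g ≗ h → reflectPoly N g ≗ reflectPoly N h
  reflectPoly-cong N g≗h l = Σ-cong N (λ j → ≡.cong (reflectWeight j l *_) (g≗h j))

  timesX : (ℕ → ℤ) → ℕ → ℤ
  timesX h zero    = + 0
  timesX h (suc j) = h j

  -- Pascal's rule for the weights: (-1-x)^(j+1) = -(1+x)(-1-x)^j.
  reflectWeight-suc : ∀ j l → reflectWeight (suc j) l ≡ - mulLin (+ 1) (λ l → reflectWeight j l) l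
  reflectWeight-suc j zero    = distribute (sign j)
    where distribute : ∀ s → - s * + 1 ≡ - (+ 1 * (s * + 1))
          distribute = solve-∀
  reflectWeight-suc j (suc l) rewrite ≡.sym (nCk+nC[k+1]≡[n+1]C[k+1] j l) | ℤP.pos-+ (j C l) (j C suc l) =
    distribute (sign j) (+ (j C l)) (+ (j C suc l))
    where distribute : ∀ s a b → - s * (a + b) ≡ - (s * a + + 1 * (s * b))
          distribute = solve-∀

  reflectPoly-timesX : ∀ N h l → reflectPoly (suc N) (timesX h) l ≡ - mulLin (+ 1) (reflectPoly N h) l
  reflectPoly-timesX N h l = begin
    reflectPoly (suc N) (timesX h) l
      ≡⟨ Σ-peel N _ ⟩
    reflectWeight 0 l * + 0 + Σ N (λ j → reflectWeight (suc j) l * h j)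
      ≡⟨ ≡.cong₂ _+_ (ℤP.*-zeroʳ (reflectWeight 0 l)) (Σ-cong N (λ j → ≡.cong (_* h j) (reflectWeight-suc j l))) ⟩
    + 0 + Σ N (λ j → - mulLin (+ 1) (λ l → reflectWeight j l) l * h j)
      ≡⟨ ℤP.+-identityˡ _ ⟩
    Σ N (λ j → - mulLin (+ 1) (λ l → reflectWeight j l) l * h j)
      ≡⟨ Σ-cong N (λ j → termwise j l) ⟩
    Σ N (λ j → - mulLin (+ 1) (λ l → reflectWeight j l * h j) l)
      ≡⟨ Σ-neg N _ ⟨
    - Σ N (λ j → mulLin (+ 1) (λ l → reflectWeight j l * h j) l)
      ≡⟨ ≡.cong -_ (Σ-mulLin l) ⟩
    - mulLin (+ 1) (reflectPoly N h) l ∎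
    where
    termwise : ∀ j l → - mulLin (+ 1) (λ l → reflectWeight j l) l * h j ≡ - mulLin (+ 1) (λ l → reflectWeight j l * h j) l
    termwise j zero    = move (reflectWeight j 0) (h j)
      where move : ∀ w x → - (+ 1 * w) * x ≡ - (+ 1 * (w * x))
            move = solve-∀
    termwise j (suc l) = move (reflectWeight j l) (reflectWeight j (suc l)) (h j)
      where move : ∀ v w x → - (v + + 1 * w) * x ≡ - (v * x + + 1 * (w * x))
            move = solve-∀
    Σ-mulLin : ∀ l → Σ N (λ j → mulLin (+ 1) (λ l → reflectWeight j l * h j) l) ≡ mulLin (+ 1) (reflectPoly N h) l
    Σ-mulLin zero    = ≡.sym (Σ-*ˡ N (+ 1) _)
    Σ-mulLin (suc l) = ≡.trans (Σ-+ N _ _) (≡.cong (_+_ (reflectPoly N h l)) (≡.sym (Σ-*ˡ N (+ 1) _)))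

  reflectPoly-mulLin : ∀ N a h → DegreeAtMost N h → ∀ l →
    reflectPoly (suc N) (mulLin a h) l ≡ - mulLin (+ 1 - a) (reflectPoly N h) l
  reflectPoly-mulLin N a h deg l = begin
    reflectPoly (suc N) (mulLin a h) l
      ≡⟨ reflectPoly-cong (suc N) split l ⟩
    Σ (suc N) (λ j → reflectWeight j l * (timesX h j + a * h j))
      ≡⟨ ≡.trans (Σ-cong (suc N) (λ j → expand (reflectWeight j l) (timesX h j) a (h j))) (Σ-+ (suc N) _ _) ⟩
    reflectPoly (suc N) (timesX h) l + Σ (suc N) (λ j → a * (reflectWeight j l * h j))
      ≡⟨ ≡.cong₂ _+_ (reflectPoly-timesX N h l) (≡.sym (Σ-*ˡ (suc N) a _)) ⟩
    - mulLin (+ 1) T l + a * (T l + reflectWeight (suc N) l * h (suc N))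
      ≡⟨ ≡.cong (λ z → - mulLin (+ 1) T l + a * (T l + reflectWeight (suc N) l * z)) (deg (suc N) ℕP.≤-refl) ⟩
    - mulLin (+ 1) T l + a * (T l + reflectWeight (suc N) l * + 0)
      ≡⟨ combine l ⟩
    - mulLin (+ 1 - a) T l ∎
    where
    T = reflectPoly N h
    split : ∀ j → mulLin a h j ≡ timesX h j + a * h j
    split zero    = ≡.sym (ℤP.+-identityˡ _)
    split (suc j) = ≡.refl
    expand : ∀ w x a y → w * (x + a * y) ≡ w * x + a * (w * y)
    expand = solve-∀
    combine : ∀ l → - mulLin (+ 1) T l + a * (T l + reflectWeight (suc N) l * + 0) ≡ - mulLin (+ 1 - a) T l
    combine zero    = simplify a (T 0) (reflectWeight (suc N) 0)
      where simplify : ∀ a t w → - (+ 1 * t) + a * (t + w * + 0) ≡ - ((+ 1 - a) * t)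
            simplify = solve-∀
    combine (suc l) = simplify a (T l) (T (suc l)) (reflectWeight (suc N) (suc l))
      where simplify : ∀ a t u w → - (t + + 1 * u) + a * (u + w * + 0) ≡ - (t + (+ 1 - a) * u)
            simplify = solve-∀

  -- Π_{k<p}(x + c_k) h(x) ↦ (-1)^p Π_{k<p}(x + 1 - c_k) h(-1-x), for deg h ≤ M.
  reflectPoly-linearProduct : ∀ c p M X → DegreeAtMost M X →
    reflectPoly (p ℕ.+ M) (linearProduct c p X) ≗ scale (sign p) (linearProduct (λ k → + 1 - c k) p (reflectPoly M X))
  reflectPoly-linearProduct c zero    M X deg l = ≡.sym (ℤP.*-identityˡ _)
  reflectPoly-linearProduct c (suc p) M X deg l = begin
    reflectPoly (suc (p ℕ.+ M)) (mulLin (c p) (linearProduct c p X)) l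
      ≡⟨ reflectPoly-mulLin (p ℕ.+ M) (c p) _ (linearProduct-degree c p M X deg) l ⟩
    - mulLin (+ 1 - c p) (reflectPoly (p ℕ.+ M) (linearProduct c p X)) l
      ≡⟨ ≡.cong -_ (mulLin-cong (+ 1 - c p) (reflectPoly-linearProduct c p M X deg) l) ⟩
    - mulLin (+ 1 - c p) (scale (sign p) (linearProduct c′ p (reflectPoly M X))) l
      ≡⟨ ≡.cong -_ (mulLin-scale (+ 1 - c p) (sign p) _ l) ⟩
    - (sign p * linearProduct c′ (suc p) (reflectPoly M X) l)
      ≡⟨ ℤP.neg-distribˡ-* (sign p) _ ⟩
    sign (suc p) * linearProduct c′ (suc p) (reflectPoly M X) l ∎
    where c′ = λ k → + 1 - c k

  reflectPoly-oneP : reflectPoly 0 oneP ≗ oneP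
  reflectPoly-oneP zero    = ≡.refl
  reflectPoly-oneP (suc l) = ≡.refl

  -- The substitution x ↦ -1-x exchanges the roots of (x)_p and [x+1]_p.
  fallingRoots-reflect : ∀ k → + 1 - fallingRoots k ≡ risingRoots k
  fallingRoots-reflect k = ≡.trans (simplify (+ k)) (≡.sym (ℤP.pos-+ 1 k))
    where simplify : ∀ k → + 1 - (- k) ≡ + 1 + k
          simplify = solve-∀

  risingRoots-reflect : ∀ k → + 1 - risingRoots k ≡ fallingRoots k
  risingRoots-reflect k = ≡.trans (≡.cong (_-_ (+ 1)) (ℤP.pos-+ 1 k)) (simplify (+ k))
    where simplify : ∀ k → + 1 - (+ 1 + k) ≡ - k
          simplify = solve-∀

  reflectPoly-Uinv : ∀ n p → p ≤ n → ∀ l →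
    reflectPoly n (Uinv n p) l ≡ sign p * (sign (n ∸ p) * linearProduct risingRoots p (falling′ (n ∸ p)) l)
  reflectPoly-Uinv n p p≤n l = begin
    reflectPoly n (Uinv n p) l
      ≡⟨ reflectPoly-cong n (Uinv≗ n p) l ⟩
    reflectPoly n (linearProduct fallingRoots p (rising′ q)) l
      ≡⟨ ≡.cong (λ N → reflectPoly N (linearProduct fallingRoots p (rising′ q)) l) n≡p+q ⟨
    reflectPoly (p ℕ.+ (q ℕ.+ 0)) (linearProduct fallingRoots p (rising′ q)) l
      ≡⟨ reflectPoly-linearProduct fallingRoots p (q ℕ.+ 0) (rising′ q) (linearProduct-degree risingRoots q 0 oneP oneP-degree) l ⟩
    sign p * linearProduct (λ k → + 1 - fallingRoots k) p (reflectPoly (q ℕ.+ 0) (rising′ q)) l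
      ≡⟨ ≡.cong (sign p *_) (linearProduct-cong fallingRoots-reflect p reflectedRising l) ⟩
    sign p * linearProduct risingRoots p (scale (sign q) (falling′ q)) l
      ≡⟨ ≡.cong (sign p *_) (linearProduct-scale risingRoots p (sign q) _ l) ⟩
    sign p * (sign q * linearProduct risingRoots p (falling′ q) l) ∎
    where
    q = n ∸ p
    n≡p+q : p ℕ.+ (q ℕ.+ 0) ≡ n
    n≡p+q = ≡.trans (≡.cong (p ℕ.+_) (ℕP.+-identityʳ q)) (ℕP.m+[n∸m]≡n p≤n)
    reflectedRising : reflectPoly (q ℕ.+ 0) (rising′ q) ≗ scale (sign q) (falling′ q)
    reflectedRising k = ≡.trans (reflectPoly-linearProduct risingRoots q 0 oneP oneP-degree k)
                                (≡.cong (sign q *_) (linearProduct-cong risingRoots-reflect q reflectPoly-oneP k))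

  sign-cancel : ∀ p q z → sign (p ℕ.+ q) * (sign p * (sign q * z)) ≡ z
  sign-cancel p q z = begin
    sign (p ℕ.+ q) * (sign p * (sign q * z))         ≡⟨ ≡.cong (_* (sign p * (sign q * z))) (sign-+ p q) ⟩
    sign p * sign q * (sign p * (sign q * z))        ≡⟨ regroup (sign p) (sign q) z ⟩
    (sign p * sign p) * (sign q * sign q) * z        ≡⟨ ≡.cong₂ (λ u v → u * v * z) (sign-sq p) (sign-sq q) ⟩
    + 1 * + 1 * z                                    ≡⟨ ℤP.*-identityˡ z ⟩
    z                                                ∎
    where regroup : ∀ a b z → a * b * (a * (b * z)) ≡ (a * a) * (b * b) * z
          regroup = solve-∀

  -- Reflection symmetry of U_n^{-1}: (x)_{n-p} [x+1]_p = (-1)^n ((x)_p [x+1]_{n-p})(-1-x),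
  -- i.e. U^{-1}(l, n-p) = Σ_j (-1)^(n+j) C(j,l) U^{-1}(j, p).
  Uinv-reflection : ∀ n l p → p ≤ n → Uinv n (n ∸ p) l ≡ Σ n (λ j → reflection n l j * Uinv n p j)
  Uinv-reflection n l p p≤n = begin
    Uinv n q l                                          ≡⟨ Uinv≗ n q l ⟩
    linearProduct fallingRoots q (rising′ (n ∸ q)) l    ≡⟨ ≡.cong (λ m → linearProduct fallingRoots q (rising′ m) l) (ℕP.m∸[m∸n]≡n p≤n) ⟩
    linearProduct fallingRoots q (rising′ p) l          ≡⟨ linearProduct-comm fallingRoots q risingRoots p oneP l ⟩
    Z                                                   ≡⟨ sign-cancel p q Z ⟨
    sign (p ℕ.+ q) * (sign p * (sign q * Z))            ≡⟨ ≡.cong₂ (λ m z → sign m * z) (≡.sym (ℕP.m+[n∸m]≡n p≤n)) (reflectPoly-Uinv n p p≤n l) ⟨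
    sign n * reflectPoly n (Uinv n p) l                 ≡⟨ Σ-*ˡ n (sign n) _ ⟩
    Σ n (λ j → sign n * (reflectWeight j l * Uinv n p j)) ≡⟨ Σ-cong n weights ⟩
    Σ n (λ j → reflection n l j * Uinv n p j)           ∎
    where
    q = n ∸ p
    Z = linearProduct risingRoots p (falling′ q) l
    weights : ∀ j → sign n * (reflectWeight j l * Uinv n p j) ≡ reflection n l j * Uinv n p j
    weights j = ≡.trans (regroup (sign n) (sign j) (+ (j C l)) (Uinv n p j))
                        (≡.cong (λ s → s * + (j C l) * Uinv n p j) (≡.sym (sign-+ n j)))
      where regroup : ∀ a b c u → a * (b * c * u) ≡ a * b * c * u
            regroup = solve-∀

-- The canonical map fromℤ : ℤ → R is a ring homomorphism, so integer
-- identities transfer to R.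
module Transfer {c ℓ} (R : CommutativeRing c ℓ) where
  open CommutativeRing R
  open Ops R using (fromℤ)
  open RingFacts R
  open RingProperties ring using (-‿+-comm; -‿distribˡ-*; -‿distribʳ-*; -‿involutive; -0#≈0#)
  open CommutativeSemigroupProperties +-commutativeSemigroup using () renaming (interchange to +-interchange)
  open import Relation.Binary.Reasoning.Setoid setoid
  module IntFacts = RingFacts ℤP.+-*-commutativeRing

  fromℤ-⊖ : ∀ m n → fromℤ (m ⊖ n) ≈ ν m - ν n
  fromℤ-⊖ zero    zero    = sym (-‿inverseʳ 0#)
  fromℤ-⊖ zero    (suc n) = sym (+-identityˡ _)
  fromℤ-⊖ (suc m) zero    = trans (sym (+-identityʳ _)) (+-congˡ (sym -0#≈0#))
  fromℤ-⊖ (suc m) (suc n) = begin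
    fromℤ (suc m ⊖ suc n)             ≡⟨ ≡.cong fromℤ (ℤP.[1+m]⊖[1+n]≡m⊖n m n) ⟩
    fromℤ (m ⊖ n)                     ≈⟨ fromℤ-⊖ m n ⟩
    ν m - ν n                         ≈⟨ +-identityˡ _ ⟨
    0# + (ν m - ν n)                  ≈⟨ +-congʳ (-‿inverseʳ 1#) ⟨
    (1# - 1#) + (ν m - ν n)           ≈⟨ +-interchange 1# (- 1#) (ν m) (- ν n) ⟩
    (1# + ν m) + (- 1# - ν n)         ≈⟨ +-congˡ (-‿+-comm 1# (ν n)) ⟩
    (1# + ν m) - (1# + ν n)           ∎

  fromℤ-neg : ∀ a → fromℤ (Int.- a) ≈ - fromℤ a
  fromℤ-neg (+ zero)  = sym -0#≈0#
  fromℤ-neg (+ suc m) = refl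
  fromℤ-neg -[1+ m ]  = sym (-‿involutive _)

  fromℤ-+ : ∀ a b → fromℤ (a Int.+ b) ≈ fromℤ a + fromℤ b
  fromℤ-+ (+ m)    (+ n)    = ν-+ m n
  fromℤ-+ (+ m)    -[1+ n ] = fromℤ-⊖ m (suc n)
  fromℤ-+ -[1+ m ] (+ n)    = trans (fromℤ-⊖ n (suc m)) (+-comm _ _)
  fromℤ-+ -[1+ m ] -[1+ n ] = begin
    - ν (suc (suc (m ℕ.+ n)))     ≡⟨ ≡.cong (λ k → - ν (suc k)) (ℕP.+-suc m n) ⟨
    - ν (suc m ℕ.+ suc n)         ≈⟨ -‿cong (ν-+ (suc m) (suc n)) ⟩
    - (ν (suc m) + ν (suc n))     ≈⟨ -‿+-comm _ _ ⟨
    - ν (suc m) + - ν (suc n)     ∎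

  fromℤ-*pos : ∀ m b → fromℤ (+ m Int.* b) ≈ ν m * fromℤ b
  fromℤ-*pos m (+ n)    = trans (reflexive (≡.cong fromℤ (≡.sym (ℤP.pos-* m n)))) (ν-* m n)
  fromℤ-*pos m -[1+ n ] = begin
    fromℤ (+ m Int.* -[1+ n ])          ≡⟨ ≡.cong fromℤ (ℤP.neg-distribʳ-* (+ m) (+ suc n)) ⟨
    fromℤ (Int.- (+ m Int.* + suc n))   ≈⟨ fromℤ-neg (+ m Int.* + suc n) ⟩
    - fromℤ (+ m Int.* + suc n)         ≈⟨ -‿cong (fromℤ-*pos m (+ suc n)) ⟩
    - (ν m * ν (suc n))                 ≈⟨ -‿distribʳ-* _ _ ⟩
    ν m * - ν (suc n)                   ∎

  fromℤ-* : ∀ a b → fromℤ (a Int.* b) ≈ fromℤ a * fromℤ b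
  fromℤ-* (+ m)    b = fromℤ-*pos m b
  fromℤ-* -[1+ m ] b = begin
    fromℤ (-[1+ m ] Int.* b)            ≡⟨ ≡.cong fromℤ (ℤP.neg-distribˡ-* (+ suc m) b) ⟨
    fromℤ (Int.- (+ suc m Int.* b))     ≈⟨ fromℤ-neg (+ suc m Int.* b) ⟩
    - fromℤ (+ suc m Int.* b)           ≈⟨ -‿cong (fromℤ-*pos (suc m) b) ⟩
    - (ν (suc m) * fromℤ b)             ≈⟨ -‿distribˡ-* _ _ ⟩
    - ν (suc m) * fromℤ b               ∎

  fromℤ-Σ : ∀ k f → fromℤ (IntFacts.Σ k f) ≈ Σ k (fromℤ ∘ f)
  fromℤ-Σ zero    f = refl
  fromℤ-Σ (suc k) f = trans (fromℤ-+ (IntFacts.Σ k f) (f (suc k))) (+-congʳ (fromℤ-Σ k f))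

  fromℤ-sign : ∀ k → fromℤ (IntFacts.sign k) ≈ sign k
  fromℤ-sign zero    = +-identityʳ 1#
  fromℤ-sign (suc k) = trans (fromℤ-neg (IntFacts.sign k)) (-‿cong (fromℤ-sign k))

module Matrices {c ℓ} (R : CommutativeRing c ℓ) (n : ℕ) where
  open CommutativeRing R
  open Ops R
  open RingFacts R using (sumFin≡sum; sum-single)
  open SemiringSum semiring using (sum; sum-cong-≋; ∑-comm; *-distribˡ-sum; *-distribʳ-sum)
  open import Relation.Binary.Reasoning.Setoid setoid

  ⊙≈sum : ∀ (A B : Mat n) i j → (A ⊙ B) i j ≡ sum (λ k → A i k * B k j)
  ⊙≈sum A B i j = sumFin≡sum (suc n) (λ k → A i k * B k j)

  ≋-setoid : Setoid c ℓ
  ≋-setoid = record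
    { Carrier       = Mat n
    ; _≈_           = _≋_
    ; isEquivalence = record
      { refl  = λ i j → refl
      ; sym   = λ A≋B i j → sym (A≋B i j)
      ; trans = λ A≋B B≋C i j → trans (A≋B i j) (B≋C i j)
      }
    }

  ⊙-cong : {A A′ B B′ : Mat n} → A ≋ A′ → B ≋ B′ → (A ⊙ B) ≋ (A′ ⊙ B′)
  ⊙-cong {A} {A′} {B} {B′} A≋A′ B≋B′ i j = begin
    (A ⊙ B) i j                          ≡⟨ ⊙≈sum A B i j ⟩
    sum (λ k → A i k * B k j)            ≈⟨ sum-cong-≋ (λ k → *-cong (A≋A′ i k) (B≋B′ k j)) ⟩
    sum (λ k → A′ i k * B′ k j)          ≡⟨ ⊙≈sum A′ B′ i j ⟨
    (A′ ⊙ B′) i j                        ∎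

  ⊙-congˡ : ∀ (A : Mat n) {B B′} → B ≋ B′ → (A ⊙ B) ≋ (A ⊙ B′)
  ⊙-congˡ A = ⊙-cong {A} {A} (λ i j → refl)

  ⊙-congʳ : ∀ (B : Mat n) {A A′} → A ≋ A′ → (A ⊙ B) ≋ (A′ ⊙ B)
  ⊙-congʳ B A≋A′ = ⊙-cong {B = B} {B′ = B} A≋A′ (λ i j → refl)

  ⊙-assoc : (K L M : Mat n) → ((K ⊙ L) ⊙ M) ≋ (K ⊙ (L ⊙ M))
  ⊙-assoc K L M i j = begin
    ((K ⊙ L) ⊙ M) i j                                           ≡⟨ ⊙≈sum (K ⊙ L) M i j ⟩
    sum (λ l → (K ⊙ L) i l * M l j)                             ≈⟨ sum-cong-≋ (λ l → *-congʳ {M l j} (reflexive (⊙≈sum K L i l))) ⟩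
    sum (λ l → sum (λ k → K i k * L k l) * M l j)               ≈⟨ sum-cong-≋ (λ l → *-distribʳ-sum (M l j) (λ k → K i k * L k l)) ⟩
    sum (λ l → sum (λ k → K i k * L k l * M l j))               ≈⟨ ∑-comm (λ l k → K i k * L k l * M l j) ⟩
    sum (λ k → sum (λ l → K i k * L k l * M l j))               ≈⟨ sum-cong-≋ (λ k → sum-cong-≋ (λ l → *-assoc (K i k) (L k l) (M l j))) ⟩
    sum (λ k → sum (λ l → K i k * (L k l * M l j)))             ≈⟨ sum-cong-≋ (λ k → *-distribˡ-sum (K i k) (λ l → L k l * M l j)) ⟨
    sum (λ k → K i k * sum (λ l → L k l * M l j))               ≈⟨ sum-cong-≋ (λ k → *-congˡ {K i k} (reflexive (⊙≈sum L M k j))) ⟨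
    sum (λ k → K i k * (L ⊙ M) k j)                             ≡⟨ ⊙≈sum K (L ⊙ M) i j ⟨
    (K ⊙ (L ⊙ M)) i j                                           ∎

  scaleMat : Carrier → Mat n → Mat n
  scaleMat s A i j = s * A i j

  scaleMat-cong : ∀ s {A B : Mat n} → A ≋ B → scaleMat s A ≋ scaleMat s B
  scaleMat-cong s A≋B i j = *-congˡ (A≋B i j)

  scaleMat-⊙ : ∀ s (A B : Mat n) → (scaleMat s A ⊙ B) ≋ scaleMat s (A ⊙ B)
  scaleMat-⊙ s A B i j = begin
    (scaleMat s A ⊙ B) i j              ≡⟨ ⊙≈sum (scaleMat s A) B i j ⟩
    sum (λ k → s * A i k * B k j)       ≈⟨ sum-cong-≋ (λ k → *-assoc s (A i k) (B k j)) ⟩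
    sum (λ k → s * (A i k * B k j))     ≈⟨ *-distribˡ-sum s (λ k → A i k * B k j) ⟨
    s * sum (λ k → A i k * B k j)       ≡⟨ ≡.cong (s *_) (⊙≈sum A B i j) ⟨
    s * (A ⊙ B) i j                     ∎

  ⊙-scaleMat : ∀ s (A B : Mat n) → (A ⊙ scaleMat s B) ≋ scaleMat s (A ⊙ B)
  ⊙-scaleMat s A B i j = begin
    (A ⊙ scaleMat s B) i j              ≡⟨ ⊙≈sum A (scaleMat s B) i j ⟩
    sum (λ k → A i k * (s * B k j))     ≈⟨ sum-cong-≋ (λ k → x∙yz≈y∙xz (A i k) s (B k j)) ⟩
    sum (λ k → s * (A i k * B k j))     ≈⟨ *-distribˡ-sum s (λ k → A i k * B k j) ⟨
    s * sum (λ k → A i k * B k j)       ≡⟨ ≡.cong (s *_) (⊙≈sum A B i j) ⟨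
    s * (A ⊙ B) i j                     ∎
    where open import Algebra.Properties.CommutativeSemigroup *-commutativeSemigroup using (x∙yz≈y∙xz)

  scaleMat-⊙-⊙ : ∀ s (K L M : Mat n) → ((scaleMat s K ⊙ L) ⊙ M) ≋ scaleMat s ((K ⊙ L) ⊙ M)
  scaleMat-⊙-⊙ s K L M i j = trans (⊙-congʳ M (scaleMat-⊙ s K L) i j) (scaleMat-⊙ s (K ⊙ L) M i j)

  scaleMat-scaleMat : ∀ s t (A : Mat n) → scaleMat s (scaleMat t A) ≋ scaleMat (s * t) A
  scaleMat-scaleMat s t A i j = sym (*-assoc s t (A i j))

  scaleMat-1# : ∀ (A : Mat n) → scaleMat 1# A ≋ A
  scaleMat-1# A i j = *-identityˡ (A i j)

  ⊙-rowSingle : ∀ (A B : Mat n) i j k₀ → (∀ k → k ≢ k₀ → A i k ≈ 0#) → (A ⊙ B) i j ≈ A i k₀ * B k₀ j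
  ⊙-rowSingle A B i j k₀ A≈0 =
    trans (reflexive (⊙≈sum A B i j)) (sum-single (suc n) (λ k → A i k * B k j) k₀ (λ k k≢k₀ → trans (*-congʳ (A≈0 k k≢k₀)) (zeroˡ (B k j))))

  ⊙-colSingle : ∀ (A B : Mat n) i j k₀ → (∀ k → k ≢ k₀ → B k j ≈ 0#) → (A ⊙ B) i j ≈ A i k₀ * B k₀ j
  ⊙-colSingle A B i j k₀ B≈0 =
    trans (reflexive (⊙≈sum A B i j)) (sum-single (suc n) (λ k → A i k * B k j) k₀ (λ k k≢k₀ → trans (*-congˡ (B≈0 k k≢k₀)) (zeroʳ (A i k))))

  if≡ : Fin (suc n) → Fin (suc n) → Carrier → Carrier
  if≡ i k x = if ⌊ i Fin.≟ k ⌋ then x else 0#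

  if≡-on : ∀ i x → if≡ i i x ≡ x
  if≡-on i x with i Fin.≟ i
  ... | yes _   = ≡.refl
  ... | no  i≢i = ⊥-elim (i≢i ≡.refl)

  if≡-off : ∀ {i k} x → i ≢ k → if≡ i k x ≡ 0#
  if≡-off {i} {k} x i≢k with i Fin.≟ k
  ... | yes i≡k = ⊥-elim (i≢k i≡k)
  ... | no  _   = ≡.refl

  diag : (Fin (suc n) → Carrier) → Mat n
  diag d i k = if≡ i k (d i)

  diag-⊙ : ∀ d (M : Mat n) i j → (diag d ⊙ M) i j ≈ d i * M i j
  diag-⊙ d M i j = trans (⊙-rowSingle (diag d) M i j i (λ k k≢i → reflexive (if≡-off (d i) (k≢i ∘ ≡.sym))))
                         (*-congʳ (reflexive (if≡-on i (d i))))

  ⊙-diag : ∀ d (M : Mat n) i j → (M ⊙ diag d) i j ≈ M i j * d j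
  ⊙-diag d M i j = trans (⊙-colSingle M (diag d) i j j (λ k k≢j → reflexive (if≡-off (d k) k≢j)))
                         (*-congˡ (reflexive (if≡-on j (d j))))

  reverse : Mat n → Mat n
  reverse M i j = M (opposite i) (opposite j)

  reverse-cong : ∀ {A B} → A ≋ B → reverse A ≋ reverse B
  reverse-cong A≋B i j = A≋B (opposite i) (opposite j)

  J-conj : (M : Mat n) → ((J n ⊙ M) ⊙ J n) ≋ reverse M
  J-conj M i j = begin
    ((J n ⊙ M) ⊙ J n) i j                          ≈⟨ ⊙-colSingle (J n ⊙ M) (J n) i j (opposite j) (λ k → reflexive ∘ if≡-off 1#) ⟩
    (J n ⊙ M) i (opposite j) * J n (opposite j) j  ≈⟨ *-cong rowReversed (reflexive (if≡-on (opposite j) 1#)) ⟩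
    M (opposite i) (opposite j) * 1#               ≈⟨ *-identityʳ _ ⟩
    M (opposite i) (opposite j)                    ∎
    where
    rowReversed : (J n ⊙ M) i (opposite j) ≈ M (opposite i) (opposite j)
    rowReversed = begin
      (J n ⊙ M) i (opposite j)                            ≈⟨ ⊙-rowSingle (J n) M i (opposite j) (opposite i) (λ k k≢ → reflexive (if≡-off 1# λ i≡ → k≢ (opposite⁻¹ i≡))) ⟩
      J n i (opposite i) * M (opposite i) (opposite j)    ≈⟨ *-congʳ (reflexive (≡.trans (≡.cong (λ z → if≡ i z 1#) (FinP.opposite-involutive i)) (if≡-on i 1#))) ⟩
      1# * M (opposite i) (opposite j)                    ≈⟨ *-identityˡ _ ⟩
      M (opposite i) (opposite j)                         ∎
      where
      opposite⁻¹ : ∀ {k} → i ≡ opposite k → k ≡ opposite i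
      opposite⁻¹ {k} i≡ = ≡.trans (≡.sym (FinP.opposite-involutive k)) (≡.cong opposite (≡.sym i≡))

-- Binomial coefficients via factorials, and the "subset of a subset" identity
-- C(I+r, I) C(I+d, I+r) = C(I+d, I) C(d, r), which makes shifts compose.
module Binomials where
  open import Data.Nat using (_+_; _*_)
  open ≡.≡-Reasoning
  open import Data.Nat.Tactic.RingSolver using (solve-∀)

  C*factorials : ∀ m k → k ≤ m → (m C k) * (k ! * (m ∸ k) !) ≡ m !
  C*factorials m k k≤m = begin
    (m C k) * (k ! * (m ∸ k) !)                       ≡⟨ ≡.cong (_* (k ! * (m ∸ k) !)) (nCk≡n!/k![n-k]! k≤m) ⟩
    (m ! / (k ! * (m ∸ k) !)) * (k ! * (m ∸ k) !)     ≡⟨ m/n*n≡m (k![n∸k]!∣n! k≤m) ⟩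
    m !                                               ∎
    where
    instance _ = ℕP._!*_!≢0 k (m ∸ k)

  C-nested : ∀ I d r → r ≤ d → ((I + r) C I) * ((I + d) C (I + r)) ≡ ((I + d) C I) * (d C r)
  C-nested I d r r≤d = ℕP.*-cancelʳ-≡ _ _ (I ! * r ! * (d ∸ r) !) {{nonZero}} (≡.trans viaSubset (≡.sym viaComplement))
    where
    nonZero : NonZero (I ! * r ! * (d ∸ r) !)
    nonZero = ℕP.m*n≢0 _ _ {{ℕP._!*_!≢0 I r}} {{ℕP._!≢0 (d ∸ r)}}
    factorials[I+r] : ((I + r) C I) * (I ! * r !) ≡ (I + r) !
    factorials[I+r] = ≡.trans (≡.cong (λ z → ((I + r) C I) * (I ! * z !)) (≡.sym (ℕP.m+n∸m≡n I r))) (C*factorials (I + r) I (ℕP.m≤m+n I r))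
    factorials[I+d]viaI+r : ((I + d) C (I + r)) * ((I + r) ! * (d ∸ r) !) ≡ (I + d) !
    factorials[I+d]viaI+r = ≡.trans (≡.cong (λ z → ((I + d) C (I + r)) * ((I + r) ! * z !)) (≡.sym (ℕP.[m+n]∸[m+o]≡n∸o I d r)))
                    (C*factorials (I + d) (I + r) (ℕP.+-monoʳ-≤ I r≤d))
    factorials[I+d]viaI : ((I + d) C I) * (I ! * d !) ≡ (I + d) !
    factorials[I+d]viaI = ≡.trans (≡.cong (λ z → ((I + d) C I) * (I ! * z !)) (≡.sym (ℕP.m+n∸m≡n I d))) (C*factorials (I + d) I (ℕP.m≤m+n I d))
    viaSubset : ((I + r) C I) * ((I + d) C (I + r)) * (I ! * r ! * (d ∸ r) !) ≡ (I + d) !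
    viaSubset = begin
      A * B * (I ! * r ! * (d ∸ r) !)   ≡⟨ regroup A B (I !) (r !) ((d ∸ r) !) ⟩
      B * ((A * (I ! * r !)) * (d ∸ r) !) ≡⟨ ≡.cong (λ z → B * (z * (d ∸ r) !)) factorials[I+r] ⟩
      B * ((I + r) ! * (d ∸ r) !)       ≡⟨ factorials[I+d]viaI+r ⟩
      (I + d) !                         ∎
      where
      A = (I + r) C I
      B = (I + d) C (I + r)
      regroup : ∀ a b x y z → a * b * (x * y * z) ≡ b * ((a * (x * y)) * z)
      regroup = solve-∀
    viaComplement : ((I + d) C I) * (d C r) * (I ! * r ! * (d ∸ r) !) ≡ (I + d) !
    viaComplement = begin
      A * B * (I ! * r ! * (d ∸ r) !)   ≡⟨ regroup A B (I !) (r !) ((d ∸ r) !) ⟩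
      A * (I ! * (B * (r ! * (d ∸ r) !))) ≡⟨ ≡.cong (λ z → A * (I ! * z)) (C*factorials d r r≤d) ⟩
      A * (I ! * d !)                   ≡⟨ factorials[I+d]viaI ⟩
      (I + d) !                         ∎
      where
      A = (I + d) C I
      B = d C r
      regroup : ∀ a b x y z → a * b * (x * y * z) ≡ a * (x * (b * (y * z)))
      regroup = solve-∀

module Shifts {c ℓ} (R : CommutativeRing c ℓ) (n : ℕ) where
  open CommutativeRing R
  open Ops R
  open RingFacts R
  open Matrices R n
  open CommutativeSemigroupProperties *-commutativeSemigroup using (interchange)
  open import Relation.Binary.Reasoning.Setoid setoid

  shift-cong : ∀ {a b} → a ≈ b → shift n a ≋ shift n b
  shift-cong a≈b i j = ×ℕ-congʳ (toℕ j C toℕ i) (^ℕ-congˡ (toℕ j ∸ toℕ i) a≈b)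

  C-vanish : ∀ {m k} x → m < k → (m C k) ×ℕ x ≈ 0#
  C-vanish x m<k rewrite k>n⇒nCk≡0 m<k = refl

  shiftTerm : Carrier → Carrier → ℕ → ℕ → ℕ → Carrier
  shiftTerm a b I J K = (K C I) ×ℕ (a ^ℕ (K ∸ I)) * ((J C K) ×ℕ (b ^ℕ (J ∸ K)))

  shiftTerm-below : ∀ a b I J K → K < I → shiftTerm a b I J K ≈ 0#
  shiftTerm-below a b I J K K<I = trans (*-congʳ (C-vanish _ K<I)) (zeroˡ _)

  shiftTerm-above : ∀ a b I J K → J < K → shiftTerm a b I J K ≈ 0#
  shiftTerm-above a b I J K J<K = trans (*-congˡ (C-vanish _ J<K)) (zeroʳ _)

  shiftTerm-between : ∀ a b I d r → r ≤ d →
    shiftTerm a b I (I ℕ.+ d) (I ℕ.+ r) ≈ ν ((I ℕ.+ d) C I) * ((d C r) ×ℕ (a ^ℕ r * b ^ℕ (d ∸ r)))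
  shiftTerm-between a b I d r r≤d = begin
    (A ×ℕ (a ^ℕ (I ℕ.+ r ∸ I))) * (B ×ℕ (b ^ℕ (I ℕ.+ d ∸ (I ℕ.+ r))))
      ≡⟨ ≡.cong₂ (λ u v → (A ×ℕ (a ^ℕ u)) * (B ×ℕ (b ^ℕ v))) (ℕP.m+n∸m≡n I r) (ℕP.[m+n]∸[m+o]≡n∸o I d r) ⟩
    (A ×ℕ (a ^ℕ r)) * (B ×ℕ (b ^ℕ (d ∸ r)))     ≈⟨ *-cong (×ℕ≈ν* A _) (×ℕ≈ν* B _) ⟩
    (ν A * a ^ℕ r) * (ν B * b ^ℕ (d ∸ r))       ≈⟨ interchange _ _ _ _ ⟩
    (ν A * ν B) * (a ^ℕ r * b ^ℕ (d ∸ r))       ≈⟨ *-congʳ (ν-* A B) ⟨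
    ν (A ℕ.* B) * (a ^ℕ r * b ^ℕ (d ∸ r))       ≡⟨ ≡.cong (λ m → ν m * (a ^ℕ r * b ^ℕ (d ∸ r))) (Binomials.C-nested I d r r≤d) ⟩
    ν (A′ ℕ.* B′) * (a ^ℕ r * b ^ℕ (d ∸ r))     ≈⟨ *-congʳ (ν-* A′ B′) ⟩
    (ν A′ * ν B′) * (a ^ℕ r * b ^ℕ (d ∸ r))     ≈⟨ *-assoc _ _ _ ⟩
    ν A′ * (ν B′ * (a ^ℕ r * b ^ℕ (d ∸ r)))     ≈⟨ *-congˡ (×ℕ≈ν* B′ _) ⟨
    ν A′ * (B′ ×ℕ (a ^ℕ r * b ^ℕ (d ∸ r)))      ∎
    where
    A = (I ℕ.+ r) C I
    B = (I ℕ.+ d) C (I ℕ.+ r)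
    A′ = (I ℕ.+ d) C I
    B′ = d C r

  shiftProduct-entry : ∀ a b I d → I ℕ.+ d ≤ n →
    Σ n (shiftTerm a b I (I ℕ.+ d)) ≈ ((I ℕ.+ d) C I) ×ℕ ((a + b) ^ℕ d)
  shiftProduct-entry a b I d J≤n = begin
    Σ n g                                         ≡⟨ ≡.cong (λ k → Σ k g) (ℕP.m+[n∸m]≡n J≤n) ⟨
    Σ (I ℕ.+ d ℕ.+ (n ∸ (I ℕ.+ d))) g             ≈⟨ Σ-dropFinalZeros (I ℕ.+ d) (n ∸ (I ℕ.+ d)) (λ K J<K → shiftTerm-above a b I (I ℕ.+ d) K J<K) ⟩
    Σ (I ℕ.+ d) g                                 ≈⟨ Σ-dropInitialZeros I d (λ K K<I → shiftTerm-below a b I (I ℕ.+ d) K K<I) ⟩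
    Σ d (λ r → g (I ℕ.+ r))                       ≈⟨ Σ-cong≤ d (shiftTerm-between a b I d) ⟩
    Σ d (λ r → ν C₀ * ((d C r) ×ℕ (a ^ℕ r * b ^ℕ (d ∸ r))))   ≈⟨ Σ-*ˡ d (ν C₀) _ ⟨
    ν C₀ * Σ d (λ r → (d C r) ×ℕ (a ^ℕ r * b ^ℕ (d ∸ r)))    ≈⟨ *-congˡ (binomial d a b) ⟨
    ν C₀ * (a + b) ^ℕ d                           ≈⟨ ×ℕ≈ν* C₀ _ ⟨
    C₀ ×ℕ ((a + b) ^ℕ d)                          ∎
    where
    g = shiftTerm a b I (I ℕ.+ d)
    C₀ = (I ℕ.+ d) C I

  toℕ≤ : (i : Fin (suc n)) → toℕ i ≤ n
  toℕ≤ i = ℕP.≤-pred (FinP.toℕ<n i)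

  shift-⊙ : ∀ a b → (shift n a ⊙ shift n b) ≋ shift n (a + b)
  shift-⊙ a b i j = trans (reflexive (⊙≈sum (shift n a) (shift n b) i j))
                          (trans (sum-toℕ n (shiftTerm a b I J′)) (byCases (I ℕ.≤? J′)))
    where
    I = toℕ i
    J′ = toℕ j
    byCases : Dec (I ≤ J′) → Σ n (shiftTerm a b I J′) ≈ (J′ C I) ×ℕ ((a + b) ^ℕ (J′ ∸ I))
    byCases (no I≰J′) = trans (Σ-zero≤ n (λ K _ → vanishing K)) (sym (C-vanish _ (ℕP.≰⇒> I≰J′)))
      where
      vanishing : ∀ K → shiftTerm a b I J′ K ≈ 0#
      vanishing K with K ℕ.<? I
      ... | yes K<I = shiftTerm-below a b I J′ K K<I
      ... | no  K≮I = shiftTerm-above a b I J′ K (ℕP.<-≤-trans (ℕP.≰⇒> I≰J′) (ℕP.≮⇒≥ K≮I))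
    byCases (yes I≤J′) = ≡.subst (λ X → Σ n (shiftTerm a b I X) ≈ (X C I) ×ℕ ((a + b) ^ℕ (J′ ∸ I))) I+[J′∸I]≡J′
                                (shiftProduct-entry a b I (J′ ∸ I) (≡.subst (_≤ n) (≡.sym I+[J′∸I]≡J′) (toℕ≤ j)))
      where I+[J′∸I]≡J′ = ℕP.m+[n∸m]≡n I≤J′

  signs : Mat n
  signs = diag (sign ∘ toℕ)

  signedShift-entry : ∀ m a I d → (sign I * m ×ℕ (a ^ℕ d)) * sign (I ℕ.+ d) ≈ m ×ℕ ((- a) ^ℕ d)
  signedShift-entry m a I d = begin
    (sign I * X) * sign (I ℕ.+ d)        ≈⟨ *-congˡ (sign-+ I d) ⟩
    (sign I * X) * (sign I * sign d)     ≈⟨ interchange _ _ _ _ ⟩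
    (sign I * sign I) * (X * sign d)     ≈⟨ *-congʳ (sign-sq I) ⟩
    1# * (X * sign d)                    ≈⟨ *-identityˡ _ ⟩
    X * sign d                           ≈⟨ *-congʳ (×ℕ≈ν* m _) ⟩
    (ν m * a ^ℕ d) * sign d              ≈⟨ *-assoc _ _ _ ⟩
    ν m * (a ^ℕ d * sign d)              ≈⟨ *-congˡ (*-comm _ _) ⟩
    ν m * (sign d * a ^ℕ d)              ≈⟨ *-congˡ (neg^ℕ a d) ⟨
    ν m * (- a) ^ℕ d                     ≈⟨ ×ℕ≈ν* m _ ⟨
    m ×ℕ ((- a) ^ℕ d)                    ∎
    where X = m ×ℕ (a ^ℕ d)

  signs-conj : ∀ a → ((signs ⊙ shift n a) ⊙ signs) ≋ shift n (- a)
  signs-conj a i j = trans (⊙-diag (sign ∘ toℕ) (signs ⊙ shift n a) i j)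
                           (trans (*-congʳ (diag-⊙ (sign ∘ toℕ) (shift n a) i j)) (byCases (I ℕ.≤? J′)))
    where
    I = toℕ i
    J′ = toℕ j
    byCases : Dec (I ≤ J′) → (sign I * shift n a i j) * sign J′ ≈ shift n (- a) i j
    byCases (no I≰J′) = trans (*-congʳ (trans (*-congˡ (C-vanish _ (ℕP.≰⇒> I≰J′))) (zeroʳ _)))
                              (trans (zeroˡ _) (sym (C-vanish _ (ℕP.≰⇒> I≰J′))))
    byCases (yes I≤J′) = ≡.subst (λ X → (sign I * (J′ C I) ×ℕ (a ^ℕ (J′ ∸ I))) * sign X ≈ (J′ C I) ×ℕ ((- a) ^ℕ (J′ ∸ I)))
                                 (ℕP.m+[n∸m]≡n I≤J′) (signedShift-entry (J′ C I) a I (J′ ∸ I))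

module ShiftConjugation {c ℓ} (R : CommutativeRing c ℓ) (n : ℕ) where
  open CommutativeRing R
  open Ops R
  open Matrices R n
  open Shifts R n
  open RingFacts R using (x-[y+x]≈-y)
  open import Relation.Binary.Reasoning.Setoid ≋-setoid

  -- (E^1 D) E^c (E^1 D) = E^1 (D E^(c+1) D) = E^1 E^(-(c+1)) = E^(-c).
  shiftSigns-conj : ∀ c → (((shift n 1# ⊙ signs) ⊙ shift n c) ⊙ (shift n 1# ⊙ signs)) ≋ shift n (- c)
  shiftSigns-conj c = begin
    ((E₁ ⊙ D) ⊙ E c) ⊙ (E₁ ⊙ D)      ≈⟨ ⊙-assoc (E₁ ⊙ D) (E c) (E₁ ⊙ D) ⟩
    (E₁ ⊙ D) ⊙ (E c ⊙ (E₁ ⊙ D))      ≈⟨ ⊙-assoc E₁ D (E c ⊙ (E₁ ⊙ D)) ⟩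
    E₁ ⊙ (D ⊙ (E c ⊙ (E₁ ⊙ D)))      ≈⟨ ⊙-congˡ E₁ (⊙-congˡ D (⊙-assoc (E c) E₁ D)) ⟨
    E₁ ⊙ (D ⊙ ((E c ⊙ E₁) ⊙ D))      ≈⟨ ⊙-congˡ E₁ (⊙-congˡ D (⊙-congʳ D (shift-⊙ c 1#))) ⟩
    E₁ ⊙ (D ⊙ (E (c + 1#) ⊙ D))      ≈⟨ ⊙-congˡ E₁ (⊙-assoc D (E (c + 1#)) D) ⟨
    E₁ ⊙ ((D ⊙ E (c + 1#)) ⊙ D)      ≈⟨ ⊙-congˡ E₁ (signs-conj (c + 1#)) ⟩
    E₁ ⊙ E (- (c + 1#))              ≈⟨ shift-⊙ 1# (- (c + 1#)) ⟩
    E (1# + - (c + 1#))              ≈⟨ shift-cong (x-[y+x]≈-y 1# c) ⟩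
    E (- c)                          ∎
    where
    E = shift n
    E₁ = shift n 1#
    D = signs

module ReflectionIdentities {c ℓ} (R : CommutativeRing c ℓ) (n : ℕ) where
  open CommutativeRing R
  open Ops R
  open RingFacts R
  open Transfer R
  open Matrices R n
  open Shifts R n using (signs; toℕ≤)
  open IntegerPolynomials using (reflection)
  open EulerReflection using (nfactU-reflection)
  open FactorialReflection using (Uinv-reflection)
  open import Relation.Binary.Reasoning.Setoid setoid

  intMat : (ℕ → ℕ → ℤ) → Mat n
  intMat F i j = fromℤ (F (toℕ i) (toℕ j))

  intMat-⊙ : ∀ F G → (intMat F ⊙ intMat G) ≋ intMat (λ i j → IntFacts.Σ n (λ k → F i k Int.* G k j))
  intMat-⊙ F G i j = begin
    (intMat F ⊙ intMat G) i j                                ≡⟨ ⊙≈sum (intMat F) (intMat G) i j ⟩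
    sum {suc n} (λ k → fromℤ (F (toℕ i) (toℕ k)) * fromℤ (G (toℕ k) (toℕ j)))
                                                             ≈⟨ sum-toℕ n (λ k → fromℤ (F (toℕ i) k) * fromℤ (G k (toℕ j))) ⟩
    Σ n (λ k → fromℤ (F (toℕ i) k) * fromℤ (G k (toℕ j)))    ≈⟨ Σ-cong n (λ k → fromℤ-* (F (toℕ i) k) (G k (toℕ j))) ⟨
    Σ n (λ k → fromℤ (F (toℕ i) k Int.* G k (toℕ j)))        ≈⟨ fromℤ-Σ n _ ⟨
    intMat (λ i j → IntFacts.Σ n (λ k → F i k Int.* G k j)) i j     ∎
    where open SemiringSum semiring using (sum)

  Zmat : Mat n
  Zmat = intMat (λ i p → nfactU n p i)

  reflectionMat : Mat n
  reflectionMat = intMat (reflection n)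

  Zmat-reflection : (λ i p → Zmat (opposite i) p) ≋ (Zmat ⊙ reflectionMat)
  Zmat-reflection i p = begin
    fromℤ (nfactU n (toℕ p) (toℕ (opposite i)))          ≡⟨ ≡.cong (λ k → fromℤ (nfactU n (toℕ p) k)) (FinP.opposite-prop i) ⟩
    fromℤ (nfactU n (toℕ p) (n ∸ toℕ i))                 ≡⟨ ≡.cong fromℤ (nfactU-reflection n (toℕ i) (toℕ p) (toℕ≤ i) (toℕ≤ p)) ⟩
    intMat (λ i p → IntFacts.Σ n (λ k → nfactU n k i Int.* reflection n k p)) i p
                                                         ≈⟨ intMat-⊙ (λ i p → nfactU n p i) (reflection n) i p ⟨
    (Zmat ⊙ reflectionMat) i p                           ∎

  Uinv-reflectionMat : (λ l p → Uinvop n l (opposite p)) ≋ (reflectionMat ⊙ Uinvop n)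
  Uinv-reflectionMat l p = begin
    fromℤ (Uinv n (toℕ (opposite p)) (toℕ l))            ≡⟨ ≡.cong (λ k → fromℤ (Uinv n k (toℕ l))) (FinP.opposite-prop p) ⟩
    fromℤ (Uinv n (n ∸ toℕ p) (toℕ l))                   ≡⟨ ≡.cong fromℤ (Uinv-reflection n (toℕ l) (toℕ p) (toℕ≤ p)) ⟩
    intMat (λ l p → IntFacts.Σ n (λ k → reflection n l k Int.* Uinv n p k)) l p
                                                         ≈⟨ intMat-⊙ (reflection n) (λ l p → Uinv n p l) l p ⟨
    (reflectionMat ⊙ Uinvop n) l p                       ∎

  reflectionMat≋ : reflectionMat ≋ scaleMat (sign n) (shift n 1# ⊙ signs)
  reflectionMat≋ j p = begin
    fromℤ (IntFacts.sign (n ℕ.+ P) Int.* + (P C J′))           ≈⟨ fromℤ-* (IntFacts.sign (n ℕ.+ P)) (+ (P C J′)) ⟩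
    fromℤ (IntFacts.sign (n ℕ.+ P)) * ν (P C J′)               ≈⟨ *-congʳ (trans (fromℤ-sign (n ℕ.+ P)) (sign-+ n P)) ⟩
    (sign n * sign P) * ν (P C J′)                      ≈⟨ *-assoc _ _ _ ⟩
    sign n * (sign P * ν (P C J′))                      ≈⟨ *-congˡ (*-comm _ _) ⟩
    sign n * (ν (P C J′) * sign P)                      ≈⟨ *-congˡ (*-congʳ unitShift) ⟨
    sign n * (shift n 1# j p * sign P)                  ≈⟨ *-congˡ (⊙-diag (sign ∘ toℕ) (shift n 1#) j p) ⟨
    sign n * (shift n 1# ⊙ signs) j p                   ∎
    where
    P = toℕ p
    J′ = toℕ j
    unitShift : shift n 1# j p ≈ ν (P C J′)
    unitShift = trans (×ℕ≈ν* (P C J′) _) (trans (*-congˡ (1^ℕ (P ∸ J′))) (*-identityʳ _))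

module Conjugation {c ℓ} (R : CommutativeRing c ℓ) (n : ℕ) where
  open CommutativeRing R
  open Ops R
  open RingFacts R using (sign; sign-sq)
  open Matrices R n
  open Shifts R n using (signs)
  open ShiftConjugation R n using (shiftSigns-conj)
  open ReflectionIdentities R n
  open import Relation.Binary.Reasoning.Setoid ≋-setoid

  -- reflection · E^c · reflection = E^(-c), since reflection = (-1)^n E^1 D.
  reflection-conj : ∀ c → ((reflectionMat ⊙ shift n c) ⊙ reflectionMat) ≋ shift n (- c)
  reflection-conj c = begin
    (Rf ⊙ shift n c) ⊙ Rf                          ≈⟨ ⊙-cong (⊙-congʳ (shift n c) reflectionMat≋) reflectionMat≋ ⟩
    (scaleMat σ M ⊙ shift n c) ⊙ scaleMat σ M      ≈⟨ scaleMat-⊙-⊙ σ M (shift n c) (scaleMat σ M) ⟩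
    scaleMat σ ((M ⊙ shift n c) ⊙ scaleMat σ M)    ≈⟨ scaleMat-cong σ (⊙-scaleMat σ (M ⊙ shift n c) M) ⟩
    scaleMat σ (scaleMat σ ((M ⊙ shift n c) ⊙ M))  ≈⟨ scaleMat-scaleMat σ σ _ ⟩
    scaleMat (σ * σ) ((M ⊙ shift n c) ⊙ M)         ≈⟨ (λ i j → *-congʳ (sign-sq n)) ⟩
    scaleMat 1# ((M ⊙ shift n c) ⊙ M)              ≈⟨ scaleMat-1# _ ⟩
    (M ⊙ shift n c) ⊙ M                            ≈⟨ shiftSigns-conj c ⟩
    shift n (- c)                                  ∎
    where
    Rf = reflectionMat
    σ = sign n
    M = shift n 1# ⊙ signs

  Zmat-shift-Uinv : ∀ c → ((Zmat ⊙ shift n (- c)) ⊙ Uinvop n) ≋ reverse ((Zmat ⊙ shift n c) ⊙ Uinvop n)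
  Zmat-shift-Uinv c = begin
    (Z ⊙ shift n (- c)) ⊙ W                  ≈⟨ ⊙-congʳ W (⊙-congˡ Z (reflection-conj c)) ⟨
    (Z ⊙ ((Rf ⊙ E) ⊙ Rf)) ⊙ W                ≈⟨ ⊙-congʳ W (⊙-assoc Z (Rf ⊙ E) Rf) ⟨
    ((Z ⊙ (Rf ⊙ E)) ⊙ Rf) ⊙ W                ≈⟨ ⊙-assoc (Z ⊙ (Rf ⊙ E)) Rf W ⟩
    (Z ⊙ (Rf ⊙ E)) ⊙ (Rf ⊙ W)                ≈⟨ ⊙-congʳ (Rf ⊙ W) (⊙-assoc Z Rf E) ⟨
    ((Z ⊙ Rf) ⊙ E) ⊙ (Rf ⊙ W)                ≈⟨ ⊙-cong (⊙-congʳ E Zmat-reflection) Uinv-reflectionMat ⟨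
    reverse ((Z ⊙ E) ⊙ W)                    ∎
    where
    Z = Zmat
    W = Uinvop n
    Rf = reflectionMat
    E = shift n c

theorem15 : ∀ {c ℓ} (R : CommutativeRing c ℓ) (inv : ℕ → CommutativeRing.Carrier R) → Ops.IsNatInverses R inv → (n : ℕ) (β : CommutativeRing.Carrier R) → Ops._≋_ R (Ops.G R inv n (CommutativeRing.-_ R β)) (Ops._⊙_ R (Ops._⊙_ R (Ops.J R n) (Ops.G R inv n β)) (Ops.J R n))
theorem15 R inv _ n β = begin
  G inv n (- β)                                         ≡⟨⟩
  (scaleMat s Zmat ⊙ shift n (n ×ℕ (- β))) ⊙ Uinvop n   ≈⟨ scaleMat-⊙-⊙ s Zmat (shift n (n ×ℕ (- β))) (Uinvop n) ⟩
  scaleMat s ((Zmat ⊙ shift n (n ×ℕ (- β))) ⊙ Uinvop n) ≈⟨ scaleMat-cong s (⊙-congʳ (Uinvop n) (⊙-congˡ Zmat (shift-cong (×ℕ-neg n β)))) ⟩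
  scaleMat s ((Zmat ⊙ shift n (- (n ×ℕ β))) ⊙ Uinvop n) ≈⟨ scaleMat-cong s (Zmat-shift-Uinv (n ×ℕ β)) ⟩
  reverse (scaleMat s ((Zmat ⊙ E₊) ⊙ Uinvop n))          ≈⟨ reverse-cong (scaleMat-⊙-⊙ s Zmat E₊ (Uinvop n)) ⟨
  reverse (G inv n β)                                   ≈⟨ J-conj (G inv n β) ⟨
  (J n ⊙ G inv n β) ⊙ J n                               ∎
  where
  open CommutativeRing R
  open Ops R
  open RingFacts R using (×ℕ-neg)
  open Matrices R n
  open Shifts R n using (shift-cong)
  open ReflectionIdentities R n using (Zmat)
  open Conjugation R n using (Zmat-shift-Uinv)
  open import Relation.Binary.Reasoning.Setoid ≋-setoid
  s = invFact inv n
  E₊ = shift n (n ×ℕ β)
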